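{- Let $X\subseteq\mathrm{PVAR}$ be finite, $\alpha\ge|X|$, and let $\varphi,\psi\in\mathrm{Type}(X,\alpha)$. Then there is a conjunction $\chi$ of literals built over $\mathrm{Core}(X,2\alpha)$ such that $\vdash_{\mathsf{C}(\ast)}(\varphi\ast\psi)\Leftrightarrow\chi$.
   Context: Logic $\mathrm{SL}(\ast,\mathrm{alloc})$: fix a countably infinite set $\mathrm{PVAR}$ of program variables. Formulae: $\varphi ::= x = y \mid x \hookrightarrow y \mid \mathrm{emp}\mid \mathrm{alloc}(x) \mid \neg\varphi \mid \varphi\wedge\varphi \mid \varphi \ast \varphi$ ($x,y\in\mathrm{PVAR}$). Abbreviations: $\bot:=\neg(x=x)$, $\top:=\neg\bot$, $\mathrm{size}\ge0:=\top$, $\mathrm{size}\ge1:=\neg\mathrm{emp}$, $\mathrm{size}\ge\beta:=\neg\mathrm{emp}\ast\mathrm{size}\ge\beta-1$ for $\beta\ge2$; $\mathrm{size}=\beta:=\mathrm{size}\ge\beta\wedge\neg\,\mathrm{size}\ge\beta+1$; $a\dot-b=\max(0,a-b)$. Core formulae: $\mathrm{Core}(X,\alpha)=\{x=y,\ \mathrm{alloc}(x),\ x\hookrightarrow y,\ \mathrm{size}\ge\beta : x,y\in X,\ \beta\in[0,\alpha]\}$; a literal is a core formula or its negation. A core type in $\mathrm{Type}(X,\alpha)$ is a conjunction of literals over $\mathrm{Core}(X,\alpha)$ in which, for each $\psi\in\mathrm{Core}(X,\alpha)$, exactly one of $\psi,\neg\psi$ occurs as a conjunct. The proof system $\mathsf{C}(\ast)$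 (derivability is the least set of formulae containing all instances of the axiom schemata, metavariables ranging over formulae, variables and naturals, and closed under the rules) consists of all axiom schemata of classical propositional calculus, modus ponens, and: (1) $x=x$; (2) $\varphi\wedge x=y\Rightarrow\varphi'$, where $\varphi'$ is obtained from $\varphi$ by replacing every occurrence of $y$ with $x$; (3) $x\hookrightarrow y\Rightarrow\mathrm{alloc}(x)$; (4) $(x\hookrightarrow y\wedge x\hookrightarrow z)\Rightarrow y=z$; (7) $(\varphi\ast\psi)\Leftrightarrow(\psi\ast\varphi)$; (8) $((\varphi\ast\psi)\ast\chi)\Leftrightarrow(\varphi\ast(\psi\ast\chi))$; (9) $((\varphi\vee\psi)\ast\chi)\Rightarrow((\varphi\ast\chi)\vee(\psi\ast\chi))$; (10) $(\bot\ast\varphi)\Leftrightarrow\bot$; (11) $\varphi\Leftrightarrow(\varphi\ast\mathrm{emp})$; (12) $(\mathrm{alloc}(x)\ast\top)\Rightarrow\mathrm{alloc}(x)$; (13) $(\mathrm{alloc}(x)\ast\mathrm{alloc}(x))\Leftrightarrow\bot$; (14) $(\xi\ast\top)\Rightarrow\xi$ for $\xi\in\{\neg\mathrm{emp},\ x=y,\ \neg(x=y),\ x\hookrightarrow y\}$; (15) $(\neg\mathrm{alloc}(x)\ast\neg\mathrm{alloc}(x))\Rightarrow\neg\mathrm{alloc}(x)$; (16) $((\mathrm{alloc}(x)\wedge\neg x\hookrightarrow y)\ast\top)\Rightarrow\neg x\hookrightarrow y$; (17) $\mathrm{alloc}(x)\Rightarrow((\mathrm{alloc}(x)\wedge\mathrm{size}=1)\ast\top)$;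 (18) $\neg\mathrm{emp}\Rightarrow(\mathrm{size}=1\ast\top)$; (19) $(\neg\,\mathrm{size}\ge\beta_1\ast\neg\,\mathrm{size}\ge\beta_2)\Rightarrow\neg\,\mathrm{size}\ge\beta_1+\beta_2\dot-1$; (20) $(\mathrm{alloc}(x)\wedge\mathrm{alloc}(y)\wedge\neg(x=y))\Rightarrow\mathrm{size}\ge2$; and the rule: from $\varphi\Rightarrow\chi$ infer $(\varphi\ast\psi)\Rightarrow(\chi\ast\psi)$. -}

module Defs where

open import Data.Nat using (ℕ; zero; suc; _+_; _*_; _∸_; _≤_; _≟_)
open import Data.Bool using (Bool; true; false; not; _∧_)
open import Data.List using (List; []; _∷_; length)
open import Data.List.Membership.Propositional using (_∈_)
open import Data.Product using (Σ; ∃; ∃-syntax; _×_; _,_)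
open import Data.Sum using (_⊎_)
open import Relation.Nullary using (¬_; yes; no)
open import Relation.Binary.PropositionalEquality using (_≡_)

PVAR : Set
PVAR = ℕ

infixr 6 _∧'_
infixr 7 _∗_

data Form : Set where
  _≐_   : PVAR → PVAR → Form
  _↪_   : PVAR → PVAR → Form
  emp   : Form
  alloc : PVAR → Form
  ¬'_   : Form → Form
  _∧'_  : Form → Form → Form
  _∗_   : Form → Form → Form

_∨'_ : Form → Form → Form
φ ∨' ψ = ¬' (¬' φ ∧' ¬' ψ)

_⇒_ : Form → Form → Form
φ ⇒ ψ = ¬' (φ ∧' ¬' ψ)

_⇔_ : Form → Form → Form
φ ⇔ ψ = (φ ⇒ ψ) ∧' (ψ ⇒ φ)

infixr 4 _⇒_ _⇔_
infixr 5 _∨'_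

-- ⊥ := ¬(x = x); we fix the variable x to be 0.
⊥' : Form
⊥' = ¬' (0 ≐ 0)

⊤' : Form
⊤' = ¬' ⊥'

sizeGe : ℕ → Form
sizeGe zero = ⊤'
sizeGe (suc zero) = ¬' emp
sizeGe (suc (suc n)) = ¬' emp ∗ sizeGe (suc n)

sizeEq : ℕ → Form
sizeEq β = sizeGe β ∧' ¬' sizeGe (suc β)

-- φ[x/y] : replace every occurrence of variable y by x
renV : PVAR → PVAR → PVAR → PVAR
renV y x z with z ≟ y
... | yes _ = x
... | no  _ = z

ren : PVAR → PVAR → Form → Form
ren y x (a ≐ b) = renV y x a ≐ renV y x b
ren y x (a ↪ b) = renV y x a ↪ renV y x b
ren y x emp = emp
ren y x (alloc a) = alloc (renV y x a)
ren y x (¬' φ) = ¬' ren y x φ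
ren y x (φ ∧' ψ) = ren y x φ ∧' ren y x ψ
ren y x (φ ∗ ψ) = ren y x φ ∗ ren y x ψ

-- Classical propositional calculus: all instances of propositional
-- tautologies (over ¬, ∧) are axioms.

data PForm : Set where
  pvar : ℕ → PForm
  pneg : PForm → PForm
  pand : PForm → PForm → PForm

peval : (ℕ → Bool) → PForm → Bool
peval v (pvar i) = v i
peval v (pneg p) = not (peval v p)
peval v (pand p q) = peval v p ∧ peval v q

Tautology : PForm → Set
Tautology p = (v : ℕ → Bool) → peval v p ≡ true

inst : (ℕ → Form) → PForm → Form
inst σ (pvar i) = σ i
inst σ (pneg p) = ¬' inst σ p
inst σ (pand p q) = inst σ p ∧' inst σ q

infix 2 ⊢_

data ⊢_ : Form → Set where
  taut  : (p : PForm) (σ : ℕ → Form) → Tautology p → ⊢ inst σ p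
  mp    : {φ ψ : Form} → ⊢ φ → ⊢ (φ ⇒ ψ) → ⊢ ψ
  ax1   : (x : PVAR) → ⊢ (x ≐ x)
  ax2   : (φ : Form) (x y : PVAR) → ⊢ (φ ∧' (x ≐ y) ⇒ ren y x φ)
  ax3   : (x y : PVAR) → ⊢ ((x ↪ y) ⇒ alloc x)
  ax4   : (x y z : PVAR) → ⊢ (((x ↪ y) ∧' (x ↪ z)) ⇒ (y ≐ z))
  ax7   : (φ ψ : Form) → ⊢ ((φ ∗ ψ) ⇔ (ψ ∗ φ))
  ax8   : (φ ψ χ : Form) → ⊢ (((φ ∗ ψ) ∗ χ) ⇔ (φ ∗ (ψ ∗ χ)))
  ax9   : (φ ψ χ : Form) → ⊢ (((φ ∨' ψ) ∗ χ) ⇒ ((φ ∗ χ) ∨' (ψ ∗ χ)))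
  ax10  : (φ : Form) → ⊢ ((⊥' ∗ φ) ⇔ ⊥')
  ax11  : (φ : Form) → ⊢ (φ ⇔ (φ ∗ emp))
  ax12  : (x : PVAR) → ⊢ ((alloc x ∗ ⊤') ⇒ alloc x)
  ax13  : (x : PVAR) → ⊢ ((alloc x ∗ alloc x) ⇔ ⊥')
  ax14a : ⊢ ((¬' emp ∗ ⊤') ⇒ ¬' emp)
  ax14b : (x y : PVAR) → ⊢ (((x ≐ y) ∗ ⊤') ⇒ (x ≐ y))
  ax14c : (x y : PVAR) → ⊢ ((¬' (x ≐ y) ∗ ⊤') ⇒ ¬' (x ≐ y))
  ax14d : (x y : PVAR) → ⊢ (((x ↪ y) ∗ ⊤') ⇒ (x ↪ y))
  ax15  : (x : PVAR) → ⊢ ((¬' alloc x ∗ ¬' alloc x) ⇒ ¬' alloc x)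
  ax16  : (x y : PVAR) → ⊢ (((alloc x ∧' ¬' (x ↪ y)) ∗ ⊤') ⇒ ¬' (x ↪ y))
  ax17  : (x : PVAR) → ⊢ (alloc x ⇒ ((alloc x ∧' sizeEq 1) ∗ ⊤'))
  ax18  : ⊢ (¬' emp ⇒ (sizeEq 1 ∗ ⊤'))
  ax19  : (β₁ β₂ : ℕ) →
          ⊢ ((¬' sizeGe β₁ ∗ ¬' sizeGe β₂) ⇒ ¬' sizeGe ((β₁ + β₂) ∸ 1))
  ax20  : (x y : PVAR) →
          ⊢ ((alloc x ∧' alloc y ∧' ¬' (x ≐ y)) ⇒ sizeGe 2)
  frame : {φ χ : Form} (ψ : Form) → ⊢ (φ ⇒ χ) → ⊢ ((φ ∗ ψ) ⇒ (χ ∗ ψ))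

-- Core formulae, literals, conjunctions, core types.
-- A finite set X ⊆ PVAR is a duplicate-free list; |X| = its length.

IsCore : List PVAR → ℕ → Form → Set
IsCore X α ψ =
    (∃[ x ] ∃[ y ] (x ∈ X × y ∈ X × ψ ≡ (x ≐ y)))
  ⊎ (∃[ x ] (x ∈ X × ψ ≡ alloc x))
  ⊎ (∃[ x ] ∃[ y ] (x ∈ X × y ∈ X × ψ ≡ (x ↪ y)))
  ⊎ (∃[ β ] (β ≤ α × ψ ≡ sizeGe β))

IsLiteral : List PVAR → ℕ → Form → Set
IsLiteral X α l = IsCore X α l ⊎ (∃[ ψ ] (IsCore X α ψ × l ≡ ¬' ψ))

conj : List Form → Form
conj [] = ⊤'
conj (l ∷ []) = l
conj (l ∷ ls@(_ ∷ _)) = l ∧' conj ls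

open import Data.List.Relation.Unary.All using (All)

IsLitConj : List PVAR → ℕ → Form → Set
IsLitConj X α χ = ∃[ L ] (All (IsLiteral X α) L × χ ≡ conj L)

IsCoreType : List PVAR → ℕ → Form → Set
IsCoreType X α φ =
  ∃[ L ] ( All (IsLiteral X α) L × φ ≡ conj L
         × ((ψ : Form) → IsCore X α ψ →
              (ψ ∈ L × ¬ (¬' ψ ∈ L)) ⊎ ((¬' ψ) ∈ L × ¬ (ψ ∈ L))))

module Submission where

-- The witness χ keeps the equalities of φ, asserts alloc x and x ↪ w exactly
-- when φ or ψ does, and asserts size ≥ s₁ + s₂ (exactly s₁ + s₂ when both types
-- bound their size by s₁, s₂).  φ ∗ ψ ⇒ χ is checked literal by literal:
-- positive facts are upward closed, negative ones combine by axioms 15, 16.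
-- Conversely, either φ ∗ ψ is refutable (the types disagree on an equality,
-- both allocate a variable, or one of them is inconsistent) and then equivalent
-- to ⊥, or χ ⇒ φ ∗ ψ: a consistent type is implied by its canonical heap (one
-- cell per allocated equality class, plus junk of the prescribed size), and χ
-- can be carved into the cells of both types and junk that splits between them.

open import Defs
open import Data.Nat using (ℕ; zero; suc; _+_; _*_; _∸_; _≤_; _<_; z≤n; s≤s; _<ᵇ_; _≡ᵇ_)
import Data.Nat as ℕ
open import Data.Nat.Properties
  using (≤-refl; ≤-reflexive; ≤-trans; ≤-pred; <⇒≤; <⇒≱; ≤∧≢⇒<; ≰⇒>; _≤?_; n≤1+n;
         m≤n⇒m≤1+n; m≤n⇒m<n∨m≡n; m≤m+n; m≤n+m∸n; m+[n∸m]≡n; +-suc; +-identityʳ; +-mono-≤;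
         ∸-+-assoc; +-∸-comm; +-∸-assoc; <ᵇ⇒<; <⇒<ᵇ; ≡ᵇ⇒≡; ≡⇒≡ᵇ)
open import Data.Bool using (Bool; true; false; not; _∧_; _∨_; if_then_else_; T)
import Data.Bool as Bool
open import Data.Bool.Properties using (∧-conicalˡ; ∧-conicalʳ; ∨-zeroʳ; ∨-identityʳ; ¬-not)
open import Data.Empty using (⊥-elim)
open import Data.Product using (∃-syntax; _×_; _,_; proj₁; proj₂)
open import Data.Sum using (_⊎_; inj₁; inj₂)
import Data.Sum.Effectful.Right as SumRight
open import Effect.Applicative using (RawApplicative)
open import Level using (0ℓ)
open import Data.List using (List; []; _∷_; _++_; map; length; filter; cartesianProductWith)
open import Data.List.Membership.Propositional using (_∈_; find)
open import Data.List.Relation.Unary.Any using (Any; here; there; any?)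
import Data.List.Relation.Unary.Any as Any
import Data.List.Relation.Unary.All as All
open All using (All)
open import Data.List.Relation.Unary.AllPairs using (AllPairs; []; _∷_)
open import Data.List.Relation.Unary.Unique.Propositional using (Unique)
open import Data.List.Properties using (++-identityʳ; ++-assoc; length-++; length-filter)
import Data.List.Relation.Unary.AllPairs.Properties as AllPairs
open import Relation.Binary.PropositionalEquality
  using (_≡_; refl; sym; trans; cong; subst; subst₂; module ≡-Reasoning)
open import Relation.Nullary using (¬_; Dec; yes; no; does)
open import Relation.Nullary.Decidable using (map′; _×-dec_)
open import Data.List.Membership.Propositional.Properties
  using (∈-filter⁻; ∈-filter⁺; ∈-cartesianProductWith⁺; ∈-cartesianProductWith⁻;
         ∈-map⁺; ∈-map⁻; ∈-++⁺ˡ; ∈-++⁺ʳ; ∈-++⁻)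

-- Propositional reasoning.
--
-- Every derived propositional rule below is an instance of a tautology in
-- at most four variables; such tautologies are certified by evaluating
-- their full truth table.

assign : ℕ → Bool → (ℕ → Bool) → (ℕ → Bool)
assign n b v i = if i ≡ᵇ n then b else v i

allRows : ℕ → (ℕ → Bool) → PForm → Bool
allRows zero v p = peval v p
allRows (suc n) v p = allRows n (assign n true v) p ∧ allRows n (assign n false v) p

peval-cong : (w v : ℕ → Bool) → (∀ i → w i ≡ v i) → (p : PForm) → peval w p ≡ peval v p
peval-cong w v w≗v (pvar i) = w≗v i
peval-cong w v w≗v (pneg p) = cong not (peval-cong w v w≗v p)
peval-cong w v w≗v (pand p q) rewrite peval-cong w v w≗v p | peval-cong w v w≗v q = refl

allRows-sound : (n : ℕ) (v : ℕ → Bool) (p : PForm) → allRows n v p ≡ true →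
                (w : ℕ → Bool) → (∀ i → n ≤ i → w i ≡ v i) → peval w p ≡ true
allRows-sound zero v p ok w agree = trans (peval-cong w v (λ i → agree i z≤n) p) ok
allRows-sound (suc n) v p ok w agree =
  allRows-sound n (assign n (w n) v) p (row (w n)) w agree′
  where
  row : (b : Bool) → allRows n (assign n b v) p ≡ true
  row true = ∧-conicalˡ _ _ ok
  row false = ∧-conicalʳ _ _ ok
  agree′ : ∀ i → n ≤ i → w i ≡ assign n (w n) v i
  agree′ i n≤i with i ≡ᵇ n in i≡ᵇn
  ... | true = cong w (≡ᵇ⇒≡ i n (subst T (sym i≡ᵇn) _))
  ... | false = agree i (≤∧≢⇒< n≤i (λ n≡i → subst T i≡ᵇn (≡⇒≡ᵇ i n (sym n≡i))))

vars : Form → Form → Form → Form → ℕ → Form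
vars A B C D 0 = A
vars A B C D 1 = B
vars A B C D 2 = C
vars A B C D _ = D

rule : (p : PForm) (A B C D : Form) → (∀ v → allRows 4 v p ≡ true) → ⊢ inst (vars A B C D) p
rule p A B C D valid = taut p (vars A B C D) (λ v → allRows-sound 4 v p (valid v) v (λ _ _ → refl))

infixr 4 _⊃_
_⊃_ : PForm → PForm → PForm
p ⊃ q = pneg (pand p (pneg q))

_or_ : PForm → PForm → PForm
p or q = pneg (pand (pneg p) (pneg q))

pa pb pc pd : PForm
pa = pvar 0
pb = pvar 1
pc = pvar 2
pd = pvar 3

⇒-refl : ∀ {A} → ⊢ (A ⇒ A)
⇒-refl {A} = rule (pa ⊃ pa) A ⊤' ⊤' ⊤' (λ _ → refl)

infixr 9 _⨾_
_⨾_ : ∀ {A B C} → ⊢ (A ⇒ B) → ⊢ (B ⇒ C) → ⊢ (A ⇒ C)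
_⨾_ {A} {B} {C} h₁ h₂ =
  mp h₂ (mp h₁ (rule ((pa ⊃ pb) ⊃ ((pb ⊃ pc) ⊃ (pa ⊃ pc))) A B C ⊤' (λ _ → refl)))

∧-intro : ∀ {A B C} → ⊢ (A ⇒ B) → ⊢ (A ⇒ C) → ⊢ (A ⇒ B ∧' C)
∧-intro {A} {B} {C} h₁ h₂ =
  mp h₂ (mp h₁ (rule ((pa ⊃ pb) ⊃ ((pa ⊃ pc) ⊃ (pa ⊃ pand pb pc))) A B C ⊤' (λ _ → refl)))

∧-fst : ∀ {A B} → ⊢ (A ∧' B ⇒ A)
∧-fst {A} {B} = rule (pand pa pb ⊃ pa) A B ⊤' ⊤' (λ _ → refl)

∧-snd : ∀ {A B} → ⊢ (A ∧' B ⇒ B)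
∧-snd {A} {B} = rule (pand pa pb ⊃ pb) A B ⊤' ⊤' (λ _ → refl)

∧-swap : ∀ {A B} → ⊢ (A ∧' B ⇒ B ∧' A)
∧-swap = ∧-intro ∧-snd ∧-fst

∧-assoc : ∀ {A B C} → ⊢ ((A ∧' B) ∧' C ⇒ A ∧' (B ∧' C))
∧-assoc = ∧-intro (∧-fst ⨾ ∧-fst) (∧-intro (∧-fst ⨾ ∧-snd) ∧-snd)

∧-map : ∀ {A B C D} → ⊢ (A ⇒ B) → ⊢ (C ⇒ D) → ⊢ (A ∧' C ⇒ B ∧' D)
∧-map h₁ h₂ = ∧-intro (∧-fst ⨾ h₁) (∧-snd ⨾ h₂)

contrapose : ∀ {A B} → ⊢ (A ⇒ B) → ⊢ (¬' B ⇒ ¬' A)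
contrapose {A} {B} h = mp h (rule ((pa ⊃ pb) ⊃ (pneg pb ⊃ pneg pa)) A B ⊤' ⊤' (λ _ → refl))

¬¬-intro : ∀ {A} → ⊢ (A ⇒ ¬' ¬' A)
¬¬-intro {A} = rule (pa ⊃ pneg (pneg pa)) A ⊤' ⊤' ⊤' (λ _ → refl)

¬¬-elim : ∀ {A} → ⊢ (¬' ¬' A ⇒ A)
¬¬-elim {A} = rule (pneg (pneg pa) ⊃ pa) A ⊤' ⊤' ⊤' (λ _ → refl)

⇔-to : ∀ {A B} → ⊢ (A ⇔ B) → ⊢ (A ⇒ B)
⇔-to {A} {B} h = mp h (rule (pand (pa ⊃ pb) (pb ⊃ pa) ⊃ (pa ⊃ pb)) A B ⊤' ⊤' (λ _ → refl))

⇔-from : ∀ {A B} → ⊢ (A ⇔ B) → ⊢ (B ⇒ A)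
⇔-from {A} {B} h = mp h (rule (pand (pa ⊃ pb) (pb ⊃ pa) ⊃ (pb ⊃ pa)) A B ⊤' ⊤' (λ _ → refl))

⇔-intro : ∀ {A B} → ⊢ (A ⇒ B) → ⊢ (B ⇒ A) → ⊢ (A ⇔ B)
⇔-intro {A} {B} h₁ h₂ = mp h₂ (mp h₁ (rule tautology A B ⊤' ⊤' (λ _ → refl)))
  where
  tautology : PForm
  tautology = (pa ⊃ pb) ⊃ ((pb ⊃ pa) ⊃ pand (pa ⊃ pb) (pb ⊃ pa))

const⇒ : ∀ {A B} → ⊢ B → ⊢ (A ⇒ B)
const⇒ {A} {B} h = mp h (rule (pb ⊃ (pa ⊃ pb)) A B ⊤' ⊤' (λ _ → refl))

⊤-intro : ∀ {A} → ⊢ (A ⇒ ⊤')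
⊤-intro = const⇒ (mp (ax1 0) ¬¬-intro)

refute : ∀ {A B C} → ⊢ (A ⇒ B) → ⊢ (A ⇒ ¬' B) → ⊢ (A ⇒ C)
refute {A} {B} {C} h₁ h₂ =
  mp h₂ (mp h₁ (rule ((pa ⊃ pb) ⊃ ((pa ⊃ pneg pb) ⊃ (pa ⊃ pc))) A B C ⊤' (λ _ → refl)))

ex-falso : ∀ {A B} → ⊢ (A ⇒ ⊥') → ⊢ (A ⇒ B)
ex-falso h = refute h ⊤-intro

¬-intro : ∀ {C a b} → ⊢ (C ∧' a ⇒ b) → ⊢ (C ⇒ ¬' b) → ⊢ (C ⇒ ¬' a)
¬-intro {C} {a} {b} h₁ h₂ = mp h₂ (mp h₁ (rule tautology C a b ⊤' (λ _ → refl)))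
  where
  tautology : PForm
  tautology = (pand pa pb ⊃ pc) ⊃ ((pa ⊃ pneg pc) ⊃ (pa ⊃ pneg pb))

∨-elim : ∀ {A B C D} → ⊢ (A ⇒ B ∨' C) → ⊢ (B ⇒ D) → ⊢ (C ⇒ D) → ⊢ (A ⇒ D)
∨-elim {A} {B} {C} {D} h₁ h₂ h₃ = mp h₃ (mp h₂ (mp h₁ (rule tautology A B C D (λ _ → refl))))
  where
  tautology : PForm
  tautology = (pa ⊃ (pb or pc)) ⊃ ((pb ⊃ pd) ⊃ ((pc ⊃ pd) ⊃ (pa ⊃ pd)))

∨-elim-right : ∀ {A B C D} → ⊢ (A ⇒ B ∨' C) → ⊢ (A ⇒ D) → ⊢ (C ⇒ ¬' D) → ⊢ (A ⇒ B)
∨-elim-right {A} {B} {C} {D} h₁ h₂ h₃ = mp h₃ (mp h₂ (mp h₁ (rule tautology A B C D (λ _ → refl))))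
  where
  tautology : PForm
  tautology = (pa ⊃ (pb or pc)) ⊃ ((pa ⊃ pd) ⊃ ((pc ⊃ pneg pd) ⊃ (pa ⊃ pb)))

excluded-middle : ∀ {A C} → ⊢ (A ⇒ (A ∧' C) ∨' (A ∧' ¬' C))
excluded-middle {A} {C} = rule (pa ⊃ (pand pa pb or pand pa (pneg pb))) A C ⊤' ⊤' (λ _ → refl)

¬∧-split : ∀ {A a P} → ⊢ (A ∧' ¬' (a ∧' P) ⇒ (A ∧' ¬' a) ∨' ((A ∧' a) ∧' ¬' P))
¬∧-split {A} {a} {P} = rule tautology A a P ⊤' (λ _ → refl)
  where
  tautology : PForm
  tautology = pand pa (pneg (pand pb pc)) ⊃ (pand pa (pneg pb) or pand (pand pa pb) (pneg pc))

∗-mapˡ : ∀ {A A′ B} → ⊢ (A ⇒ A′) → ⊢ (A ∗ B ⇒ A′ ∗ B)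
∗-mapˡ {B = B} h = frame B h

∗-comm : ∀ {A B} → ⊢ (A ∗ B ⇒ B ∗ A)
∗-comm {A} {B} = ⇔-to (ax7 A B)

∗-mapʳ : ∀ {A B B′} → ⊢ (B ⇒ B′) → ⊢ (A ∗ B ⇒ A ∗ B′)
∗-mapʳ h = ∗-comm ⨾ ∗-mapˡ h ⨾ ∗-comm

∗-map : ∀ {A A′ B B′} → ⊢ (A ⇒ A′) → ⊢ (B ⇒ B′) → ⊢ (A ∗ B ⇒ A′ ∗ B′)
∗-map h₁ h₂ = ∗-mapˡ h₁ ⨾ ∗-mapʳ h₂

∗-assoc : ∀ {A B C} → ⊢ ((A ∗ B) ∗ C ⇒ A ∗ (B ∗ C))
∗-assoc {A} {B} {C} = ⇔-to (ax8 A B C)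

∗-assoc⁻ : ∀ {A B C} → ⊢ (A ∗ (B ∗ C) ⇒ (A ∗ B) ∗ C)
∗-assoc⁻ {A} {B} {C} = ⇔-from (ax8 A B C)

∗-interchange : ∀ {A B C D} → ⊢ ((A ∗ B) ∗ (C ∗ D) ⇒ (A ∗ C) ∗ (B ∗ D))
∗-interchange = ∗-assoc ⨾ ∗-mapʳ ∗-assoc⁻ ⨾ ∗-mapʳ (∗-mapˡ ∗-comm) ⨾ ∗-mapʳ ∗-assoc ⨾ ∗-assoc⁻

∗-⊥ˡ : ∀ {A B} → ⊢ (A ⇒ ⊥') → ⊢ (A ∗ B ⇒ ⊥')
∗-⊥ˡ {A} {B} h = ∗-mapˡ h ⨾ ⇔-to (ax10 B)

∗-⊥ʳ : ∀ {A B} → ⊢ (B ⇒ ⊥') → ⊢ (A ∗ B ⇒ ⊥')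
∗-⊥ʳ h = ∗-comm ⨾ ∗-⊥ˡ h

∗-split : ∀ {A B C D} → ⊢ (A ⇒ B ∨' C) → ⊢ (A ∗ D ⇒ (B ∗ D) ∨' (C ∗ D))
∗-split {B = B} {C} {D} h = ∗-mapˡ h ⨾ ax9 B C D

∗-emp : ∀ {A} → ⊢ (A ⇒ A ∗ emp)
∗-emp {A} = ⇔-to (ax11 A)

∗-emp⁻ : ∀ {A} → ⊢ (A ∗ emp ⇒ A)
∗-emp⁻ {A} = ⇔-from (ax11 A)

∗-⊤ : ∀ {A} → ⊢ (A ⇒ A ∗ ⊤')
∗-⊤ = ∗-emp ⨾ ∗-mapʳ ⊤-intro

-- Upward closed formulae: those preserved by extending the heap.
-- Exactly these can be read off from a single ∗-component.

Up : Form → Set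
Up ξ = ⊢ (ξ ∗ ⊤' ⇒ ξ)

Up-cong : ∀ {a b} → ⊢ (a ⇒ b) → ⊢ (b ⇒ a) → Up a → Up b
Up-cong h₁ h₂ u = ∗-mapˡ h₂ ⨾ u ⨾ h₁

Up-¬¬ : ∀ {a} → Up a → Up (¬' ¬' a)
Up-¬¬ u = Up-cong ¬¬-intro ¬¬-elim u

Up-sizeGe : ∀ k → Up (sizeGe k)
Up-sizeGe zero = ⊤-intro
Up-sizeGe (suc zero) = ax14a
Up-sizeGe (suc (suc k)) = ∗-assoc ⨾ ∗-mapʳ (Up-sizeGe (suc k))

Up-fromˡ : ∀ {A B c} → Up c → ⊢ (A ⇒ c) → ⊢ (A ∗ B ⇒ c)
Up-fromˡ u h = ∗-map h ⊤-intro ⨾ u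

Up-fromʳ : ∀ {A B c} → Up c → ⊢ (B ⇒ c) → ⊢ (A ∗ B ⇒ c)
Up-fromʳ u h = ∗-comm ⨾ Up-fromˡ u h

sizeGe-suc : ∀ k → ⊢ (sizeGe (suc k) ⇒ ¬' emp ∗ sizeGe k)
sizeGe-suc zero = ∗-⊤
sizeGe-suc (suc k) = ⇒-refl

sizeGe-suc⁻ : ∀ k → ⊢ (¬' emp ∗ sizeGe k ⇒ sizeGe (suc k))
sizeGe-suc⁻ zero = ax14a
sizeGe-suc⁻ (suc k) = ⇒-refl

sizeGe-mono : ∀ {m n} → m ≤ n → ⊢ (sizeGe n ⇒ sizeGe m)
sizeGe-mono {zero} _ = ⊤-intro
sizeGe-mono {suc m} {suc n} (s≤s m≤n) =
  sizeGe-suc n ⨾ ∗-mapʳ (sizeGe-mono m≤n) ⨾ sizeGe-suc⁻ m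

sizeGe-+ : ∀ a b → ⊢ (sizeGe a ∗ sizeGe b ⇒ sizeGe (a + b))
sizeGe-+ zero b = Up-fromʳ (Up-sizeGe b) ⇒-refl
sizeGe-+ (suc a) b =
  ∗-mapˡ (sizeGe-suc a) ⨾ ∗-assoc ⨾ ∗-mapʳ (sizeGe-+ a b) ⨾ sizeGe-suc⁻ (a + b)

sizeGe-split : ∀ a b → ⊢ (sizeGe (a + b) ⇒ sizeGe a ∗ sizeGe b)
sizeGe-split zero b = ∗-⊤ ⨾ ∗-comm
sizeGe-split (suc a) b =
  sizeGe-suc (a + b) ⨾ ∗-mapʳ (sizeGe-split a b) ⨾ ∗-assoc⁻ ⨾ ∗-mapˡ (sizeGe-suc⁻ a)

sizeLt-+ : ∀ a b → ⊢ (¬' sizeGe (suc a) ∗ ¬' sizeGe (suc b) ⇒ ¬' sizeGe (suc (a + b)))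
sizeLt-+ a b =
  subst (λ k → ⊢ (¬' sizeGe (suc a) ∗ ¬' sizeGe (suc b) ⇒ ¬' sizeGe k)) (+-suc a b) (ax19 (suc a) (suc b))

sizeEq-+ : ∀ a b → ⊢ (sizeEq a ∗ sizeEq b ⇒ sizeEq (a + b))
sizeEq-+ a b = ∧-intro (∗-map ∧-fst ∧-fst ⨾ sizeGe-+ a b) (∗-map ∧-snd ∧-snd ⨾ sizeLt-+ a b)

sizeGe-exact : ∀ k → ⊢ (sizeGe k ⇒ sizeEq k ∗ ⊤')
sizeGe-exact zero = ∗-emp ⨾ ∗-comm ⨾ ∗-map (∧-intro ⊤-intro ¬¬-intro) ⊤-intro
sizeGe-exact (suc k) =
  sizeGe-suc k ⨾ ∗-map ax18 (sizeGe-exact k) ⨾ ∗-interchange ⨾ ∗-map (sizeEq-+ 1 k) ⊤-intro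

sizeIs : Bool → ℕ → Form
sizeIs true k = sizeEq k
sizeIs false k = sizeGe k

sizeIs⇒sizeGe : ∀ exact k → ⊢ (sizeIs exact k ⇒ sizeGe k)
sizeIs⇒sizeGe true k = ∧-fst
sizeIs⇒sizeGe false k = ⇒-refl

sizeIs-+ : ∀ exact a b → ⊢ (sizeEq a ∗ sizeIs exact b ⇒ sizeIs exact (a + b))
sizeIs-+ true a b = sizeEq-+ a b
sizeIs-+ false a b = ∗-mapˡ ∧-fst ⨾ sizeGe-+ a b

renV-self : ∀ y x → renV y x y ≡ x
renV-self y x with y ℕ.≟ y
... | yes _ = refl
... | no y≢y = ⊥-elim (y≢y refl)

renV-other : ∀ y x z → ¬ (z ≡ y) → renV y x z ≡ z
renV-other y x z z≢y with z ℕ.≟ y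
... | yes z≡y = ⊥-elim (z≢y z≡y)
... | no _ = refl

-- axiom (2) read backwards: x = y and P[x/y] give P
≐-subst : ∀ P x y → ⊢ ((x ≐ y) ∧' ren y x P ⇒ P)
≐-subst P x y = mp (ax2 (¬' P) x y) (rule tautology P (x ≐ y) (ren y x P) ⊤' (λ _ → refl))
  where
  tautology : PForm
  tautology = (pand (pneg pa) pb ⊃ pneg pc) ⊃ (pand pb pc ⊃ pa)

≐-sym : ∀ x y → ⊢ (x ≐ y ⇒ y ≐ x)
≐-sym x y with x ℕ.≟ y
... | yes refl = ⇒-refl
... | no x≢y = ∧-intro ⇒-refl (const⇒ (ax1 x)) ⨾ y≐x
  where
  y≐x : ⊢ ((x ≐ y) ∧' (x ≐ x) ⇒ (y ≐ x))
  y≐x = subst₂ (λ u v → ⊢ ((x ≐ y) ∧' (u ≐ v) ⇒ (y ≐ x)))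
               (renV-self y x) (renV-other y x x x≢y) (≐-subst (y ≐ x) x y)

alloc-cong : ∀ x y → ⊢ ((x ≐ y) ∧' alloc x ⇒ alloc y)
alloc-cong x y = subst (λ z → ⊢ ((x ≐ y) ∧' alloc z ⇒ alloc y)) (renV-self y x) (≐-subst (alloc y) x y)

-- congruence of the source of a pointer; the case w = y needs two substitutions
↪-cong : ∀ x y w → ⊢ ((x ≐ y) ∧' (x ↪ w) ⇒ (y ↪ w))
↪-cong x y w with x ℕ.≟ y
... | yes refl = ∧-snd
... | no x≢y with w ℕ.≟ y
...   | no w≢y = subst₂ (λ u v → ⊢ ((x ≐ y) ∧' (u ↪ v) ⇒ (y ↪ w)))
                   (renV-self y x) (renV-other y x w w≢y) (≐-subst (y ↪ w) x y)
...   | yes refl = ∧-intro ∧-fst x↪x ⨾ w↪w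
  where
  x↪x : ⊢ ((x ≐ w) ∧' (x ↪ w) ⇒ (x ↪ x))
  x↪x = ∧-swap ⨾ subst₂ (λ u v → ⊢ ((x ↪ w) ∧' (x ≐ w) ⇒ (u ↪ v)))
                         (renV-other w x x x≢y) (renV-self w x) (ax2 (x ↪ w) x w)
  w↪w : ⊢ ((x ≐ w) ∧' (x ↪ x) ⇒ (w ↪ w))
  w↪w = subst (λ z → ⊢ ((x ≐ w) ∧' (z ↪ z) ⇒ (w ↪ w))) (renV-self w x) (≐-subst (w ↪ w) x w)

-- Decidable equality of formulae (used to read the polarity of a core
-- formula off the literal list of a core type).

tag : Form → ℕ
tag (_ ≐ _) = 0
tag (_ ↪ _) = 1
tag emp = 2
tag (alloc _) = 3
tag (¬' _) = 4
tag (_ ∧' _) = 5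
tag (_ ∗ _) = 6

dec₂ : ∀ {A : Set} {a b c d : A} (f : A → A → Form) →
       (f a b ≡ f c d → a ≡ c × b ≡ d) → Dec (a ≡ c × b ≡ d) → Dec (f a b ≡ f c d)
dec₂ f injective = map′ (λ { (refl , refl) → refl }) injective

_≟F_ : (φ ψ : Form) → Dec (φ ≡ ψ)
sameTag : (φ ψ : Form) → tag φ ≡ tag ψ → Dec (φ ≡ ψ)

φ ≟F ψ with tag φ ℕ.≟ tag ψ
... | yes same = sameTag φ ψ same
... | no differ = no (λ φ≡ψ → differ (cong tag φ≡ψ))

sameTag (a ≐ b) (c ≐ d) _ = dec₂ _≐_ (λ { refl → refl , refl }) (a ℕ.≟ c ×-dec b ℕ.≟ d)
sameTag (a ↪ b) (c ↪ d) _ = dec₂ _↪_ (λ { refl → refl , refl }) (a ℕ.≟ c ×-dec b ℕ.≟ d)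
sameTag emp emp _ = yes refl
sameTag (alloc a) (alloc c) _ = map′ (cong alloc) (λ { refl → refl }) (a ℕ.≟ c)
sameTag (¬' a) (¬' c) _ = map′ (cong ¬'_) (λ { refl → refl }) (a ≟F c)
sameTag (a ∧' b) (c ∧' d) _ = dec₂ _∧'_ (λ { refl → refl , refl }) (a ≟F c ×-dec b ≟F d)
sameTag (a ∗ b) (c ∗ d) _ = dec₂ _∗_ (λ { refl → refl , refl }) (a ≟F c ×-dec b ≟F d)

open import Data.List.Membership.DecPropositional _≟F_ using () renaming (_∈?_ to _∈F?_)

map-all : ∀ {A B : Set} (P : B → Set) (f : A → B) {xs} → (∀ x → x ∈ xs → P (f x)) →
          ∀ {b} → b ∈ map f xs → P b
map-all P f h b∈ = let (x , x∈xs , b≡) = ∈-map⁻ f b∈ in subst P (sym b≡) (h x x∈xs)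

pairs-all : ∀ {A B : Set} (P : B → Set) (f : A → A → B) (xs : List A) →
            (∀ x y → x ∈ xs → y ∈ xs → P (f x y)) → ∀ {b} → b ∈ cartesianProductWith f xs xs → P b
pairs-all P f xs h b∈ =
  let (x , y , x∈xs , y∈xs , b≡) = ∈-cartesianProductWith⁻ f xs xs b∈
  in subst P (sym b≡) (h x y x∈xs y∈xs)

⋀ : List Form → Form
⋀ [] = ⊤'
⋀ (a ∷ as) = a ∧' ⋀ as

⋀-elim : ∀ {a L} → a ∈ L → ⊢ (⋀ L ⇒ a)
⋀-elim (here refl) = ∧-fst
⋀-elim (there a∈L) = ∧-snd ⨾ ⋀-elim a∈L

⋀-intro : ∀ {G} L → (∀ {a} → a ∈ L → ⊢ (G ⇒ a)) → ⊢ (G ⇒ ⋀ L)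
⋀-intro [] h = ⊤-intro
⋀-intro (a ∷ L) h = ∧-intro (h (here refl)) (⋀-intro L (λ a∈L → h (there a∈L)))

⋀-intro-map : ∀ {A : Set} {G} (f : A → Form) (xs : List A) →
              (∀ x → x ∈ xs → ⊢ (G ⇒ f x)) → ⊢ (G ⇒ ⋀ (map f xs))
⋀-intro-map {G = G} f xs h = ⋀-intro (map f xs) (map-all (λ l → ⊢ (G ⇒ l)) f h)

⋀-elim-map : ∀ {A : Set} (f : A → Form) {x : A} {xs : List A} → x ∈ xs → ⊢ (⋀ (map f xs) ⇒ f x)
⋀-elim-map f x∈xs = ⋀-elim (∈-map⁺ f x∈xs)

conj-elim : ∀ {a} L → a ∈ L → ⊢ (conj L ⇒ a)
conj-elim (b ∷ []) (here refl) = ⇒-refl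
conj-elim (b ∷ c ∷ L) (here refl) = ∧-fst
conj-elim (b ∷ c ∷ L) (there a∈L) = ∧-snd ⨾ conj-elim (c ∷ L) a∈L

conj-intro : ∀ {G} L → (∀ {a} → a ∈ L → ⊢ (G ⇒ a)) → ⊢ (G ⇒ conj L)
conj-intro [] h = ⊤-intro
conj-intro (b ∷ []) h = h (here refl)
conj-intro (b ∷ c ∷ L) h = ∧-intro (h (here refl)) (conj-intro (c ∷ L) (λ a∈L → h (there a∈L)))

lit : Bool → Form → Form
lit true ψ = ψ
lit false ψ = ¬' ψ

Up-lit-≐ : ∀ b x y → Up (lit b (x ≐ y))
Up-lit-≐ true x y = ax14b x y
Up-lit-≐ false x y = ax14c x y

-- Transfer: pushing a fact of the whole heap into one ∗-component.
--
-- In general, c may be added to the left component of  A ∗ B  (in context Γ)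
-- when a left component violating c would refute a consequence g of Γ.
refineˡ : ∀ {Γ A B c g} → ⊢ (Γ ⇒ A ∗ B) → ⊢ ((A ∧' ¬' c) ∗ B ⇒ ¬' g) → ⊢ (Γ ⇒ g) →
          ⊢ (Γ ⇒ (A ∧' c) ∗ B)
refineˡ h refutes g = ∨-elim-right (h ⨾ ∗-split excluded-middle) g refutes

refineʳ : ∀ {Γ A B c g} → ⊢ (Γ ⇒ A ∗ B) → ⊢ (A ∗ (B ∧' ¬' c) ⇒ ¬' g) → ⊢ (Γ ⇒ g) →
          ⊢ (Γ ⇒ A ∗ (B ∧' c))
refineʳ h refutes g = refineˡ (h ⨾ ∗-comm) (∗-comm ⨾ refutes) g ⨾ ∗-comm

refine-forcedʳ : ∀ {Γ A B c} → ⊢ (Γ ⇒ A ∗ B) → ⊢ (A ∗ (B ∧' ¬' c) ⇒ ⊥') →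
                 ⊢ (Γ ⇒ A ∗ (B ∧' c))
refine-forcedʳ h contra = refineʳ {g = ⊤'} h (ex-falso contra) ⊤-intro

-- The special case g = c: a fact l of the whole transfers into the left
-- component when a left component violating l makes the whole violate l.
Transfer : Form → Form → Form → Set
Transfer A B l = ⊢ ((A ∧' ¬' l) ∗ B ⇒ ¬' l)

transferˡ : ∀ {Γ A B c} → ⊢ (Γ ⇒ A ∗ B) → Transfer A B c → ⊢ (Γ ⇒ c) →
            ⊢ (Γ ⇒ (A ∧' c) ∗ B)
transferˡ = refineˡ

transferʳ : ∀ {Γ A B c} → ⊢ (Γ ⇒ A ∗ B) → Transfer B A c → ⊢ (Γ ⇒ c) →
            ⊢ (Γ ⇒ A ∗ (B ∧' c))
transferʳ h t = refineʳ h (∗-comm ⨾ t)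

Transfer-weaken : ∀ {A A′ B B′ l} → ⊢ (A′ ⇒ A) → ⊢ (B′ ⇒ B) → Transfer A B l →
                  Transfer A′ B′ l
Transfer-weaken hA hB t = ∗-map (∧-map hA ⇒-refl) hB ⨾ t

Transfer-⊤ : ∀ {A B} → Transfer A B ⊤'
Transfer-⊤ = ex-falso (∗-⊥ˡ (∧-snd ⨾ ¬¬-elim))

-- conjunctions transfer componentwise, later conjuncts may use earlier ones
Transfer-∧ : ∀ {A B a P} → Transfer A B a → Transfer (A ∧' a) B P → Transfer A B (a ∧' P)
Transfer-∧ ta tP = ∨-elim (∗-split ¬∧-split) (ta ⨾ contrapose ∧-fst) (tP ⨾ contrapose ∧-snd)

Transfer-⋀ : ∀ {A B} L → (∀ {l} → l ∈ L → Transfer A B l) → Transfer A B (⋀ L)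
Transfer-⋀ [] t = Transfer-⊤
Transfer-⋀ (l ∷ L) t =
  Transfer-∧ (t (here refl)) (Transfer-weaken ∧-fst ⇒-refl (Transfer-⋀ L (λ l∈L → t (there l∈L))))

Transfer-Up : ∀ {A B l} → Up (¬' l) → Transfer A B l
Transfer-Up u = ∗-map ∧-snd ⊤-intro ⨾ u

Transfer-↪ : ∀ {A B x w} → ⊢ (A ⇒ alloc x) → Transfer A B (x ↪ w)
Transfer-↪ {x = x} {w} h = ∗-map (∧-map h ⇒-refl) ⊤-intro ⨾ ax16 x w

Transfer-alloc : ∀ {A B z} → ⊢ (A ⇒ ¬' alloc z) → Transfer B A (alloc z)
Transfer-alloc {z = z} h = ∗-map ∧-snd h ⨾ ax15 z

Transfer-¬alloc : ∀ {A B z} → Transfer A B (¬' alloc z)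
Transfer-¬alloc {z = z} = Transfer-Up (Up-¬¬ (ax12 z))

Transfer-lit-≐ : ∀ {A B} b x y → Transfer A B (lit b (x ≐ y))
Transfer-lit-≐ true x y = Transfer-Up (ax14c x y)
Transfer-lit-≐ false x y = Transfer-Up (Up-¬¬ (ax14b x y))

Transfer-lit-↪ : ∀ {A B x w} b → ⊢ (A ⇒ alloc x) → Transfer A B (lit b (x ↪ w))
Transfer-lit-↪ true h = Transfer-↪ h
Transfer-lit-↪ {x = x} {w} false h = Transfer-Up (Up-¬¬ (ax14d x w))

-- components of sizes ≥ a and ≥ b make a heap of size ≥ n for n ≤ a + b
-- (in the double-negated form in which refinements consume it)
private
  ¬¬-sizeGe-+ : ∀ {A B a b n} → ⊢ (A ⇒ sizeGe a) → ⊢ (B ⇒ sizeGe b) → n ≤ a + b →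
                ⊢ (A ∗ B ⇒ ¬' ¬' sizeGe n)
  ¬¬-sizeGe-+ {a = a} {b} hA hB n≤ = ∗-map hA hB ⨾ sizeGe-+ a b ⨾ sizeGe-mono n≤ ⨾ ¬¬-intro

size-peel-≥ : ∀ {Γ A B} s → ⊢ (A ⇒ sizeEq 1) → ⊢ (Γ ⇒ sizeGe s) → ⊢ (Γ ⇒ A ∗ B) →
              ⊢ (Γ ⇒ A ∗ (B ∧' sizeGe (s ∸ 1)))
size-peel-≥ zero one size h = h ⨾ ∗-mapʳ (∧-intro ⇒-refl ⊤-intro)
size-peel-≥ (suc s) one size h = refineʳ h (∗-map (one ⨾ ∧-snd) ∧-snd ⨾ ax19 2 s) size

size-peel : ∀ {Γ A B} exact s → ⊢ (A ⇒ sizeEq 1) → ⊢ (Γ ⇒ sizeIs exact s) → ⊢ (Γ ⇒ A ∗ B) →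
            ⊢ (Γ ⇒ A ∗ (B ∧' sizeIs exact (s ∸ 1)))
size-peel false s one size h = size-peel-≥ s one size h
size-peel {Γ} {A} {B} true s one size h = refineʳ lower upper (size ⨾ ∧-snd) ⨾ ∗-mapʳ ∧-assoc
  where
  lower : ⊢ (Γ ⇒ A ∗ (B ∧' sizeGe (s ∸ 1)))
  lower = size-peel-≥ s one (size ⨾ ∧-fst) h
  s≤1+[s∸1] : ∀ s → s ≤ suc (s ∸ 1)
  s≤1+[s∸1] zero = z≤n
  s≤1+[s∸1] (suc s) = s≤s ≤-refl
  upper : ⊢ (A ∗ ((B ∧' sizeGe (s ∸ 1)) ∧' ¬' ¬' sizeGe (suc (s ∸ 1))) ⇒ ¬' ¬' sizeGe (suc s))
  upper = ¬¬-sizeGe-+ {a = 1} (one ⨾ ∧-fst) (∧-snd ⨾ ¬¬-elim) (s≤s (s≤1+[s∸1] s))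

sizeEq-split : ∀ a b → ⊢ (sizeEq (a + b) ⇒ sizeEq a ∗ sizeEq b)
sizeEq-split a b = refineʳ exactˡ (¬¬-sizeGe-+ ∧-fst (∧-snd ⨾ ¬¬-elim) a+1+b≤) ∧-snd
  where
  a+1+b≤ : suc (a + b) ≤ a + suc b
  a+1+b≤ = ≤-reflexive (sym (+-suc a b))
  exactˡ : ⊢ (sizeEq (a + b) ⇒ sizeEq a ∗ sizeGe b)
  exactˡ = refineˡ (∧-fst ⨾ sizeGe-split a b) (¬¬-sizeGe-+ (∧-snd ⨾ ¬¬-elim) ⇒-refl ≤-refl) ∧-snd

sizeGe-exactˡ : ∀ a b → ⊢ (sizeGe a ∗ sizeGe b ⇒ sizeEq a ∗ sizeGe b)
sizeGe-exactˡ a b = ∗-mapˡ (sizeGe-exact a) ⨾ ∗-assoc ⨾ ∗-mapʳ (∗-comm ⨾ Up-sizeGe b)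

sizeIs-split : ∀ e₁ e₂ a b → ⊢ (sizeIs (e₁ ∧ e₂) (a + b) ⇒ sizeIs e₁ a ∗ sizeIs e₂ b)
sizeIs-split true true a b = sizeEq-split a b
sizeIs-split true false a b = sizeGe-split a b ⨾ sizeGe-exactˡ a b
sizeIs-split false true a b = sizeGe-split a b ⨾ ∗-comm ⨾ sizeGe-exactˡ b a ⨾ ∗-comm
sizeIs-split false false a b = sizeGe-split a b

-- Canonical heaps.
--
-- Fix a finite set X of variables, a pointer pattern pts and a formula Π
-- that settles all (in)equalities between variables and can be transferred
-- into any ∗-component.  A canonical heap consists of one cell per
-- representative r of an allocated equivalence class, pointing to the
-- variables of X exactly as pts prescribes, and of junk: memory that
-- allocates no variable of X and is only constrained in size.

¬alloc : PVAR → Form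
¬alloc z = ¬' alloc z

module CanonicalHeap (X : List PVAR) (pts : PVAR → PVAR → Bool) (Π : Form)
                     (Π-transfers : ∀ {A B} → Transfer A B Π) where

  pointers : PVAR → Form
  pointers r = ⋀ (map (λ w → lit (pts r w) (r ↪ w)) X)

  allocInfo : PVAR → Form
  allocInfo r = alloc r ∧' pointers r

  cell : PVAR → Form
  cell r = (alloc r ∧' sizeEq 1) ∧' pointers r

  Cells : List PVAR → Form
  Cells [] = emp
  Cells (r ∷ rs) = cell r ∗ Cells rs

  unalloc : List PVAR → Form
  unalloc W = ⋀ (map ¬alloc W)

  Junk : List PVAR → Bool → ℕ → Form
  Junk W exact k = unalloc W ∧' sizeIs exact k

  -- what the whole heap must satisfy for the cells of rs to be carved out of it
  Carvable : List PVAR → List PVAR → Bool → ℕ → Form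
  Carvable rs Z exact s = ⋀ (map allocInfo rs) ∧' (unalloc Z ∧' sizeIs exact s)

  Distinct : List PVAR → Set
  Distinct = AllPairs (λ r r′ → ⊢ (Π ⇒ ¬' (r ≐ r′)))

  cell⇒alloc : ∀ {r} → ⊢ (cell r ⇒ alloc r)
  cell⇒alloc = ∧-fst ⨾ ∧-fst

  cell⇒size1 : ∀ {r} → ⊢ (cell r ⇒ sizeEq 1)
  cell⇒size1 = ∧-fst ⨾ ∧-snd

  cell-¬alloc : ∀ {r x} → ⊢ (Π ⇒ ¬' (r ≐ x)) → ⊢ (cell r ∧' Π ⇒ ¬' alloc x)
  cell-¬alloc {r} {x} r≢x =
    ¬-intro (∧-intro (∧-fst ⨾ ∧-fst ⨾ cell⇒alloc) (∧-intro ∧-snd (∧-fst ⨾ ∧-snd ⨾ r≢x)) ⨾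
                     ax20 r x)
            (∧-fst ⨾ cell⇒size1 ⨾ ∧-snd)

  unalloc-++ : ∀ Z W → ⊢ (unalloc Z ∧' unalloc W ⇒ unalloc (Z ++ W))
  unalloc-++ [] W = ∧-snd
  unalloc-++ (z ∷ Z) W = ∧-intro (∧-fst ⨾ ∧-fst) (∧-map ∧-snd ⇒-refl ⨾ unalloc-++ Z W)

  private
    Transfer-⋀-map : ∀ {I : Set} {A B} (f : I → Form) (xs : List I) →
                     (∀ x → x ∈ xs → Transfer A B (f x)) → Transfer A B (⋀ (map f xs))
    Transfer-⋀-map f xs t = Transfer-⋀ (map f xs) (map-all (Transfer _ _) f t)

    Transfer-pointers : ∀ {A B r} → ⊢ (A ⇒ alloc r) → Transfer A B (pointers r)
    Transfer-pointers {r = r} h = Transfer-⋀-map _ X (λ w _ → Transfer-lit-↪ (pts r w) h)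

  -- Carve the cell of r out of a heap satisfying Π ∧ Carvable (r ∷ rs) Z:
  -- split off a one-cell heap allocating r (axiom 17) and transfer into
  -- both sides everything they inherit.
  carve-step : ∀ r rs Z exact s → All (λ r′ → ⊢ (Π ⇒ ¬' (r ≐ r′))) rs →
               ⊢ (Π ∧' Carvable (r ∷ rs) Z exact s ⇒
                  cell r ∗ (Π ∧' Carvable rs (Z ++ r ∷ []) exact (s ∸ 1)))
  carve-step r rs Z exact s r≢rs = h₇ ⨾ ∗-map ∧-fst remainder
    where
    Γ C : Form
    Γ = Π ∧' Carvable (r ∷ rs) Z exact s
    C = cell r ∧' Π
    B₃ B₄ B₅ B₆ B₇ : Form
    B₃ = ⊤' ∧' Π
    B₄ = B₃ ∧' ⋀ (map allocInfo rs)
    B₅ = B₄ ∧' unalloc Z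
    B₆ = B₅ ∧' ¬alloc r
    B₇ = B₆ ∧' sizeIs exact (s ∸ 1)
    Γ-info : ⊢ (Γ ⇒ allocInfo r)
    Γ-info = ∧-snd ⨾ ∧-fst ⨾ ∧-fst
    h₁ : ⊢ (Γ ⇒ cell r ∗ ⊤')
    h₁ = transferˡ (Γ-info ⨾ ∧-fst ⨾ ax17 r) (Transfer-pointers ∧-fst) (Γ-info ⨾ ∧-snd)
    h₃ : ⊢ (Γ ⇒ C ∗ B₃)
    h₃ = transferʳ (transferˡ h₁ Π-transfers ∧-fst) Π-transfers ∧-fst
    -- the other representatives, which the cell of r does not allocate
    h₄ : ⊢ (Γ ⇒ C ∗ B₄)
    h₄ = transferʳ h₃ (Transfer-⋀-map allocInfo rs λ r′ r′∈rs →
                         Transfer-∧ (Transfer-alloc (cell-¬alloc (All.lookup r≢rs r′∈rs)))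
                                    (Transfer-pointers ∧-snd))
                      (∧-snd ⨾ ∧-fst ⨾ ∧-snd)
    h₅ : ⊢ (Γ ⇒ C ∗ B₅)
    h₅ = transferʳ h₄ (Transfer-⋀-map ¬alloc Z λ _ _ → Transfer-¬alloc) (∧-snd ⨾ ∧-snd ⨾ ∧-fst)
    -- r is allocated by its cell, hence not by the rest   (axiom 13)
    h₆ : ⊢ (Γ ⇒ C ∗ B₆)
    h₆ = refine-forcedʳ h₅ (∗-map (∧-fst ⨾ cell⇒alloc) (∧-snd ⨾ ¬¬-elim) ⨾ ⇔-to (ax13 r))
    h₇ : ⊢ (Γ ⇒ C ∗ B₇)
    h₇ = size-peel exact s (∧-fst ⨾ cell⇒size1) (∧-snd ⨾ ∧-snd ⨾ ∧-snd) h₆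
    remainder : ⊢ (B₇ ⇒ Π ∧' Carvable rs (Z ++ r ∷ []) exact (s ∸ 1))
    remainder = ∧-intro (∧-fst ⨾ ∧-fst ⨾ ∧-fst ⨾ ∧-fst ⨾ ∧-snd)
                  (∧-intro (∧-fst ⨾ ∧-fst ⨾ ∧-fst ⨾ ∧-snd)
                    (∧-intro (∧-fst ⨾ ∧-map ∧-snd (∧-intro ⇒-refl ⊤-intro) ⨾ unalloc-++ Z (r ∷ []))
                             ∧-snd))

  carve : ∀ rs Z exact s → Distinct rs →
          ⊢ (Π ∧' Carvable rs Z exact s ⇒ Cells rs ∗ Junk (Z ++ rs) exact (s ∸ length rs))
  carve [] Z exact s _ =
    subst (λ W → ⊢ (Π ∧' Carvable [] Z exact s ⇒ emp ∗ Junk W exact s)) (sym (++-identityʳ Z))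
          (∧-snd ⨾ ∧-snd ⨾ ∗-emp ⨾ ∗-comm)
  carve (r ∷ rs) Z exact s (r≢rs ∷ distinct) =
    carve-step r rs Z exact s r≢rs ⨾ ∗-mapʳ rest ⨾ ∗-assoc⁻
    where
    Γ′ : Form
    Γ′ = Π ∧' Carvable rs (Z ++ r ∷ []) exact (s ∸ 1)
    rest : ⊢ (Γ′ ⇒ Cells rs ∗ Junk (Z ++ r ∷ rs) exact (s ∸ suc (length rs)))
    rest = subst₂ (λ W k → ⊢ (Γ′ ⇒ Cells rs ∗ Junk W exact k))
                  (++-assoc Z (r ∷ []) rs) (∸-+-assoc s 1 (length rs))
                  (carve rs (Z ++ r ∷ []) exact (s ∸ 1) distinct)

  Cells-size : ∀ rs → ⊢ (Cells rs ⇒ sizeEq (length rs))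
  Cells-size [] = ∧-intro ⊤-intro ¬¬-intro
  Cells-size (r ∷ rs) = ∗-map cell⇒size1 (Cells-size rs) ⨾ sizeEq-+ 1 (length rs)

  canonical-size : ∀ rs W exact k → ⊢ (Cells rs ∗ Junk W exact k ⇒ sizeIs exact (length rs + k))
  canonical-size rs W exact k = ∗-map (Cells-size rs) ∧-snd ⨾ sizeIs-+ exact (length rs) k

  cell-of : ∀ {r} rs → r ∈ rs → ⊢ (Cells rs ⇒ cell r ∗ ⊤')
  cell-of (r ∷ rs) (here refl) = ∗-mapʳ ⊤-intro
  cell-of (r′ ∷ rs) (there r∈rs) =
    ∗-mapʳ (cell-of rs r∈rs) ⨾ ∗-assoc⁻ ⨾ ∗-mapˡ ∗-comm ⨾ ∗-assoc ⨾ ∗-mapʳ ⊤-intro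

  Cells-++ : ∀ rs qs → ⊢ (Cells (rs ++ qs) ⇒ Cells rs ∗ Cells qs)
  Cells-++ [] qs = ∗-emp ⨾ ∗-comm
  Cells-++ (r ∷ rs) qs = ∗-mapʳ (Cells-++ rs qs) ⨾ ∗-assoc⁻

  Cells-¬alloc : ∀ {Rest} x rs → (∀ r → r ∈ rs → ⊢ (Π ⇒ ¬' (r ≐ x))) →
                 ⊢ (Rest ⇒ ¬' alloc x) → ⊢ (Π ∧' (Cells rs ∗ Rest) ⇒ ¬' alloc x)
  Cells-¬alloc x [] r≢x rest = ∧-snd ⨾ ∗-comm ⨾ ∗-emp⁻ ⨾ rest
  Cells-¬alloc x (r ∷ rs) r≢x rest =
    transferʳ (transferˡ (∧-snd ⨾ ∗-assoc) Π-transfers ∧-fst) Π-transfers ∧-fst ⨾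
    ∗-map (cell-¬alloc (r≢x r (here refl)))
          (∧-swap ⨾ Cells-¬alloc x rs (λ r′ r′∈ → r≢x r′ (there r′∈)) rest) ⨾
    ax15 x

  Junk-split : ∀ W e₁ e₂ k₁ k₂ →
               ⊢ (Junk W (e₁ ∧ e₂) (k₁ + k₂) ⇒ Junk W e₁ k₁ ∗ Junk W e₂ k₂)
  Junk-split W e₁ e₂ k₁ k₂ =
    transferʳ (transferˡ (∧-snd ⨾ sizeIs-split e₁ e₂ k₁ k₂) unalloc-transfers ∧-fst)
              unalloc-transfers ∧-fst ⨾
    ∗-map ∧-swap ∧-swap
    where
    unalloc-transfers : ∀ {A B} → Transfer A B (unalloc W)
    unalloc-transfers = Transfer-⋀-map ¬alloc W (λ _ _ → Transfer-¬alloc)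

clash : ∀ {b : Bool} {A : Set} → b ≡ true → b ≡ false → A
clash refl ()

all-or : ∀ {A : Set} {P : A → Set} {Z : Set} (xs : List A) →
         (∀ x → x ∈ xs → P x ⊎ Z) → (∀ x → x ∈ xs → P x) ⊎ Z
all-or [] h = inj₁ (λ x ())
all-or (x ∷ xs) h with h x (here refl) | all-or xs (λ y m → h y (there m))
... | inj₂ z | _ = inj₂ z
... | inj₁ _ | inj₂ z = inj₂ z
... | inj₁ px | inj₁ pxs = inj₁ λ { y (here refl) → px ; y (there m) → pxs y m }

AllPairs-lookup : ∀ {R : ℕ → ℕ → Set} {xs r r′} → AllPairs R xs → r ∈ xs → r′ ∈ xs →
                  ¬ (r ≡ r′) → R r r′ ⊎ R r′ r
AllPairs-lookup (h ∷ hs) (here refl) (here refl) r≢r′ = ⊥-elim (r≢r′ refl)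
AllPairs-lookup (h ∷ hs) (here refl) (there m′) r≢r′ = inj₁ (All.lookup h m′)
AllPairs-lookup (h ∷ hs) (there m) (here refl) r≢r′ = inj₂ (All.lookup h m)
AllPairs-lookup (h ∷ hs) (there m) (there m′) r≢r′ = AllPairs-lookup hs m m′ r≢r′

[a+b]∸[c+d]≡[a∸c]+[b∸d] : ∀ a b {c d} → c ≤ a → d ≤ b →
                          (a + b) ∸ (c + d) ≡ (a ∸ c) + (b ∸ d)
[a+b]∸[c+d]≡[a∸c]+[b∸d] a b {c} {d} c≤a d≤b = begin
  (a + b) ∸ (c + d)   ≡⟨ sym (∸-+-assoc (a + b) c d) ⟩
  (a + b) ∸ c ∸ d     ≡⟨ cong (_∸ d) (+-∸-comm b c≤a) ⟩
  (a ∸ c + b) ∸ d     ≡⟨ +-∸-assoc (a ∸ c) d≤b ⟩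
  (a ∸ c) + (b ∸ d)   ∎
  where open ≡-Reasoning

-- the largest β ≤ n satisfying g (or 0)
top : (ℕ → Bool) → ℕ → ℕ
top g zero = zero
top g (suc n) = if g (suc n) then suc n else top g n

top≤ : ∀ g n → top g n ≤ n
top≤ g zero = z≤n
top≤ g (suc n) with g (suc n)
... | true = ≤-refl
... | false = m≤n⇒m≤1+n (top≤ g n)

top-holds : ∀ g n → g (top g n) ≡ true ⊎ top g n ≡ 0
top-holds g zero = inj₂ refl
top-holds g (suc n) with g (suc n) in g[n+1]
... | true = inj₁ g[n+1]
... | false = top-holds g n

top-max : ∀ g n β → β ≤ n → top g n < β → g β ≡ false
top-max g zero β z≤n ()
top-max g (suc n) β β≤ top< with g (suc n) in g[n+1]
... | true = ⊥-elim (<⇒≱ top< β≤)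
... | false with β ℕ.≟ suc n
...   | yes refl = g[n+1]
...   | no β≢ = top-max g n β (≤-pred (≤∧≢⇒< β≤ β≢)) top<

-- One representative for each E-class met in a list: reps acc xs keeps the
-- members of xs that are not E-related to an already kept element or to acc.
module Representatives (E : PVAR → PVAR → Bool) where

  seen? : ∀ x acc → Dec (Any (λ y → E y x ≡ true) acc)
  seen? x acc = any? (λ y → E y x Bool.≟ true) acc

  reps : List PVAR → List PVAR → List PVAR
  reps acc [] = []
  reps acc (x ∷ xs) with seen? x acc
  ... | yes _ = reps acc xs
  ... | no _ = x ∷ reps (x ∷ acc) xs

  reps-⊆ : ∀ acc xs {r} → r ∈ reps acc xs → r ∈ xs
  reps-⊆ acc (x ∷ xs) r∈ with seen? x acc
  reps-⊆ acc (x ∷ xs) r∈ | yes _ = there (reps-⊆ acc xs r∈)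
  reps-⊆ acc (x ∷ xs) (here refl) | no _ = here refl
  reps-⊆ acc (x ∷ xs) (there r∈) | no _ = there (reps-⊆ (x ∷ acc) xs r∈)

  reps-length : ∀ acc xs → length (reps acc xs) ≤ length xs
  reps-length acc [] = z≤n
  reps-length acc (x ∷ xs) with seen? x acc
  ... | yes _ = m≤n⇒m≤1+n (reps-length acc xs)
  ... | no _ = s≤s (reps-length (x ∷ acc) xs)

  reps-fresh : ∀ acc xs {r y} → r ∈ reps acc xs → y ∈ acc → E y r ≡ false
  reps-fresh acc (x ∷ xs) r∈ y∈ with seen? x acc
  reps-fresh acc (x ∷ xs) r∈ y∈ | yes _ = reps-fresh acc xs r∈ y∈
  reps-fresh acc (x ∷ xs) (here refl) y∈ | no unseen =
    ¬-not (λ Eyx → unseen (Any.map (λ { refl → Eyx }) y∈))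
  reps-fresh acc (x ∷ xs) (there r∈) y∈ | no _ = reps-fresh (x ∷ acc) xs r∈ (there y∈)

  reps-unrelated : ∀ acc xs → AllPairs (λ r r′ → E r r′ ≡ false) (reps acc xs)
  reps-unrelated acc [] = []
  reps-unrelated acc (x ∷ xs) with seen? x acc
  ... | yes _ = reps-unrelated acc xs
  ... | no _ = All.tabulate (λ r∈ → reps-fresh (x ∷ acc) xs r∈ (here refl)) ∷ reps-unrelated (x ∷ acc) xs

  reps-cover : ∀ acc xs {x} → x ∈ xs → E x x ≡ true →
               (∃[ r ] (r ∈ acc × E r x ≡ true)) ⊎ (∃[ r ] (r ∈ reps acc xs × E r x ≡ true))
  reps-cover acc (z ∷ xs) x∈ Exx with seen? z acc
  reps-cover acc (z ∷ xs) (here refl) Exx | yes seen = inj₁ (find seen)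
  reps-cover acc (z ∷ xs) (there x∈) Exx | yes _ = reps-cover acc xs x∈ Exx
  reps-cover acc (z ∷ xs) (here refl) Exx | no _ = inj₂ (z , here refl , Exx)
  reps-cover acc (z ∷ xs) (there x∈) Exx | no _ with reps-cover (z ∷ acc) xs x∈ Exx
  ... | inj₁ (r , here refl , Erx) = inj₂ (r , here refl , Erx)
  ... | inj₁ (r , there r∈ , Erx) = inj₁ (r , r∈ , Erx)
  ... | inj₂ (r , r∈ , Erx) = inj₂ (r , there r∈ , Erx)

module _ {X : List PVAR} {β : ℕ} where

  core-≐ : ∀ {x y} → x ∈ X → y ∈ X → IsCore X β (x ≐ y)
  core-≐ {x} {y} x∈X y∈X = inj₁ (x , y , x∈X , y∈X , refl)

  core-alloc : ∀ {x} → x ∈ X → IsCore X β (alloc x)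
  core-alloc {x} x∈X = inj₂ (inj₁ (x , x∈X , refl))

  core-↪ : ∀ {x y} → x ∈ X → y ∈ X → IsCore X β (x ↪ y)
  core-↪ {x} {y} x∈X y∈X = inj₂ (inj₂ (inj₁ (x , y , x∈X , y∈X , refl)))

  core-size : ∀ {γ} → γ ≤ β → IsCore X β (sizeGe γ)
  core-size {γ} γ≤β = inj₂ (inj₂ (inj₂ (γ , γ≤β , refl)))

  lit-literal : ∀ b {ψ} → IsCore X β ψ → IsLiteral X β (lit b ψ)
  lit-literal true c = inj₁ c
  lit-literal false {ψ} c = inj₂ (ψ , c , refl)

-- The polarity a core type gives to each core formula, and the facts
-- that φ proves exactly these literals.
module CoreType (X : List PVAR) (α : ℕ) (φ : Form) (type : IsCoreType X α φ) where

  private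
    L : List Form
    L = proj₁ type
    literals : All (IsLiteral X α) L
    literals = proj₁ (proj₂ type)
    φ≡conj : φ ≡ conj L
    φ≡conj = proj₁ (proj₂ (proj₂ type))
    exactly-one : (ψ : Form) → IsCore X α ψ →
                  (ψ ∈ L × ¬ (¬' ψ ∈ L)) ⊎ ((¬' ψ) ∈ L × ¬ (ψ ∈ L))
    exactly-one = proj₂ (proj₂ (proj₂ type))

  pol : Form → Bool
  pol ψ = does (ψ ∈F? L)

  private
    lit∈ : ∀ ψ → IsCore X α ψ → lit (pol ψ) ψ ∈ L
    lit∈ ψ c with ψ ∈F? L | exactly-one ψ c
    ... | yes ψ∈L | _ = ψ∈L
    ... | no ψ∉L | inj₁ (ψ∈L , _) = ⊥-elim (ψ∉L ψ∈L)
    ... | no _ | inj₂ (¬ψ∈L , _) = ¬ψ∈L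

  proves : ∀ ψ → IsCore X α ψ → ⊢ (φ ⇒ lit (pol ψ) ψ)
  proves ψ c = subst (λ φ → ⊢ (φ ⇒ lit (pol ψ) ψ)) (sym φ≡conj) (conj-elim L (lit∈ ψ c))

  proves-as : ∀ {ψ} b → IsCore X α ψ → pol ψ ≡ b → ⊢ (φ ⇒ lit b ψ)
  proves-as {ψ} b c refl = proves ψ c

  characterised : ∀ {G} → (∀ ψ → IsCore X α ψ → ⊢ (G ⇒ lit (pol ψ) ψ)) → ⊢ (G ⇒ φ)
  characterised {G} h =
    subst (λ φ → ⊢ (G ⇒ φ)) (sym φ≡conj) (conj-intro L λ l∈L → literal (All.lookup literals l∈L) l∈L)
    where
    literal : ∀ {l} → IsLiteral X α l → l ∈ L → ⊢ (G ⇒ l)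
    literal {l} (inj₁ c) l∈L with l ∈F? L | h l c
    ... | yes _ | G⇒l = G⇒l
    ... | no l∉L | _ = ⊥-elim (l∉L l∈L)
    literal (inj₂ (ψ , c , refl)) ¬ψ∈L with ψ ∈F? L | h ψ c | exactly-one ψ c
    ... | no _ | G⇒¬ψ | _ = G⇒¬ψ
    ... | yes _ | _ | inj₁ (_ , ¬ψ∉L) = ⊥-elim (¬ψ∉L ¬ψ∈L)
    ... | yes ψ∈L | _ | inj₂ (_ , ψ∉L) = ⊥-elim (ψ∉L ψ∈L)

  -- The size information of φ: size ≥ s for the largest s ≤ α it asserts,
  -- and size = s when φ moreover denies size ≥ s + 1 (i.e. when s < α).
  sizeGe? : ℕ → Bool
  sizeGe? β = pol (sizeGe β)

  s : ℕ
  s = top sizeGe? α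

  bounded : Bool
  bounded = s <ᵇ α

  s≤α : s ≤ α
  s≤α = top≤ sizeGe? α

  bounded⇒s<α : bounded ≡ true → s < α
  bounded⇒s<α b = <ᵇ⇒< s α (subst T (sym b) _)

  unbounded⇒s≡α : bounded ≡ false → s ≡ α
  unbounded⇒s≡α b with m≤n⇒m<n∨m≡n s≤α
  ... | inj₂ s≡α = s≡α
  ... | inj₁ s<α = ⊥-elim (subst T b (<⇒<ᵇ s<α))

  proves-lower : ⊢ (φ ⇒ sizeGe s)
  proves-lower with top-holds sizeGe? α
  ... | inj₁ holds = proves-as true (core-size s≤α) holds
  ... | inj₂ s≡0 = subst (λ k → ⊢ (φ ⇒ sizeGe k)) (sym s≡0) ⊤-intro

  proves-upper : bounded ≡ true → ⊢ (φ ⇒ ¬' sizeGe (suc s))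
  proves-upper b =
    proves-as false (core-size (bounded⇒s<α b)) (top-max sizeGe? α (suc s) (bounded⇒s<α b) ≤-refl)

  proves-size : ⊢ (φ ⇒ sizeIs bounded s)
  proves-size with bounded in b
  ... | false = proves-lower
  ... | true = ∧-intro proves-lower (proves-upper b)

module EqualityPattern (X : List PVAR) (E : PVAR → PVAR → Bool) where

  ≐-lit : PVAR → PVAR → Form
  ≐-lit x y = lit (E x y) (x ≐ y)

  ≐-lits : List Form
  ≐-lits = cartesianProductWith ≐-lit X X

  Π : Form
  Π = ⋀ ≐-lits

  Π-transfers : ∀ {A B} → Transfer A B Π
  Π-transfers = Transfer-⋀ ≐-lits (pairs-all (Transfer _ _) ≐-lit X λ x y _ _ → Transfer-lit-≐ (E x y) x y)

  Π-lit : ∀ {x y} → x ∈ X → y ∈ X → ⊢ (Π ⇒ ≐-lit x y)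
  Π-lit x∈X y∈X = ⋀-elim (∈-cartesianProductWith⁺ ≐-lit x∈X y∈X)

  Π-≐ : ∀ {x y} → x ∈ X → y ∈ X → E x y ≡ true → ⊢ (Π ⇒ (x ≐ y))
  Π-≐ {x} {y} x∈X y∈X Exy = subst (λ b → ⊢ (Π ⇒ lit b (x ≐ y))) Exy (Π-lit x∈X y∈X)

  Π-≢ : ∀ {x y} → x ∈ X → y ∈ X → E x y ≡ false → ⊢ (Π ⇒ ¬' (x ≐ y))
  Π-≢ {x} {y} x∈X y∈X Exy = subst (λ b → ⊢ (Π ⇒ lit b (x ≐ y))) Exy (Π-lit x∈X y∈X)

  distinct : ∀ {rs} → (∀ {r} → r ∈ rs → r ∈ X) → AllPairs (λ r r′ → E r r′ ≡ false) rs →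
             AllPairs (λ r r′ → ⊢ (Π ⇒ ¬' (r ≐ r′))) rs
  distinct sub [] = []
  distinct sub (unrelated ∷ unrelateds) =
    All.tabulate (λ r′∈ → Π-≢ (sub (here refl)) (sub (there r′∈)) (All.lookup unrelated r′∈)) ∷
    distinct (λ r∈ → sub (there r∈)) unrelateds

-- A single core type φ, read through an equality pattern E agreeing with
-- its own equality literals, is either refutable or described by a
-- canonical heap: cells for the allocated E-representatives A, and junk.

module Canonical (X : List PVAR) (α : ℕ) (|X|≤α : length X ≤ α)
                 (φ : Form) (type : IsCoreType X α φ) (E : PVAR → PVAR → Bool)
                 (E-agrees : ∀ {x y} → x ∈ X → y ∈ X → CoreType.pol X α φ type (x ≐ y) ≡ E x y)
                 where

  open CoreType X α φ type public
  open EqualityPattern X E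
  open Representatives E

  allocs : PVAR → Bool
  allocs x = pol (alloc x)

  points : PVAR → PVAR → Bool
  points x w = pol (x ↪ w)

  Absurd : Set
  Absurd = ⊢ (φ ⇒ ⊥')

  φ⇒Π : ⊢ (φ ⇒ Π)
  φ⇒Π = ⋀-intro ≐-lits (pairs-all (λ l → ⊢ (φ ⇒ l)) ≐-lit X λ x y x∈X y∈X →
                           proves-as (E x y) (core-≐ x∈X y∈X) (E-agrees x∈X y∈X))

  allocated? : ∀ r → Dec (allocs r ≡ true)
  allocated? r = allocs r Bool.≟ true

  R : List PVAR
  R = reps [] X

  A : List PVAR
  A = filter allocated? R

  R⊆X : ∀ {r} → r ∈ R → r ∈ X
  R⊆X r∈R = reps-⊆ [] X r∈R

  A⊆R : ∀ {r} → r ∈ A → r ∈ R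
  A⊆R r∈A = proj₁ (∈-filter⁻ allocated? {xs = R} r∈A)

  A⊆X : ∀ {r} → r ∈ A → r ∈ X
  A⊆X r∈A = R⊆X (A⊆R r∈A)

  A-allocated : ∀ {r} → r ∈ A → allocs r ≡ true
  A-allocated r∈A = proj₂ (∈-filter⁻ allocated? {xs = R} r∈A)

  A-unrelated : AllPairs (λ r r′ → E r r′ ≡ false) A
  A-unrelated = AllPairs.filter⁺ allocated? (reps-unrelated [] X)

  |A|≤α : length A ≤ α
  |A|≤α = ≤-trans (length-filter allocated? R) (≤-trans (reps-length [] X) |X|≤α)

  record Consistent : Set where
    constructor consistent
    field
      E-refl : ∀ x → x ∈ X → E x x ≡ true
      E-sym : ∀ x → x ∈ X → ∀ y → y ∈ X → E x y ≡ true → E y x ≡ true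
      alloc-resp : ∀ x → x ∈ X → ∀ y → y ∈ X →
                   E x y ≡ true → allocs x ≡ true → allocs y ≡ true
      points-resp : ∀ x → x ∈ X → ∀ y → y ∈ X → ∀ w → w ∈ X →
                    E x y ≡ true → points x w ≡ true → points y w ≡ true
      points⇒allocs : ∀ x → x ∈ X → ∀ w → w ∈ X → points x w ≡ true → allocs x ≡ true
      size-down : ∀ β → β ≤ s → sizeGe? β ≡ true
      enough-size : length A ≤ s

  private
    check-refl : ∀ x → x ∈ X → E x x ≡ true ⊎ Absurd
    check-refl x x∈X with E x x in Exx
    ... | true = inj₁ refl
    ... | false = inj₂ (refute (const⇒ (ax1 x)) (φ⇒Π ⨾ Π-≢ x∈X x∈X Exx))

    check-sym : ∀ x → x ∈ X → ∀ y → y ∈ X → (E x y ≡ true → E y x ≡ true) ⊎ Absurd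
    check-sym x x∈X y y∈X with E x y in Exy | E y x in Eyx
    ... | false | _ = inj₁ (λ ())
    ... | true | true = inj₁ (λ _ → refl)
    ... | true | false =
      inj₂ (refute (φ⇒Π ⨾ Π-≐ x∈X y∈X Exy ⨾ ≐-sym x y) (φ⇒Π ⨾ Π-≢ y∈X x∈X Eyx))

    check-alloc : ∀ x → x ∈ X → ∀ y → y ∈ X →
                  (E x y ≡ true → allocs x ≡ true → allocs y ≡ true) ⊎ Absurd
    check-alloc x x∈X y y∈X with E x y in Exy | allocs x in ax | allocs y in ay
    ... | false | _ | _ = inj₁ (λ ())
    ... | true | false | _ = inj₁ (λ _ ())
    ... | true | true | true = inj₁ (λ _ _ → refl)
    ... | true | true | false =
      inj₂ (refute (∧-intro (φ⇒Π ⨾ Π-≐ x∈X y∈X Exy) (proves-as true (core-alloc x∈X) ax) ⨾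
                    alloc-cong x y)
                   (proves-as false (core-alloc y∈X) ay))

    check-points : ∀ x → x ∈ X → ∀ y → y ∈ X → ∀ w → w ∈ X →
                   (E x y ≡ true → points x w ≡ true → points y w ≡ true) ⊎ Absurd
    check-points x x∈X y y∈X w w∈X with E x y in Exy | points x w in pxw | points y w in pyw
    ... | false | _ | _ = inj₁ (λ ())
    ... | true | false | _ = inj₁ (λ _ ())
    ... | true | true | true = inj₁ (λ _ _ → refl)
    ... | true | true | false =
      inj₂ (refute (∧-intro (φ⇒Π ⨾ Π-≐ x∈X y∈X Exy) (proves-as true (core-↪ x∈X w∈X) pxw) ⨾
                    ↪-cong x y w)
                   (proves-as false (core-↪ y∈X w∈X) pyw))

    check-points-alloc : ∀ x → x ∈ X → ∀ w → w ∈ X →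
                         (points x w ≡ true → allocs x ≡ true) ⊎ Absurd
    check-points-alloc x x∈X w w∈X with points x w in pxw | allocs x in ax
    ... | false | _ = inj₁ (λ ())
    ... | true | true = inj₁ (λ _ → refl)
    ... | true | false =
      inj₂ (refute (proves-as true (core-↪ x∈X w∈X) pxw ⨾ ax3 x w) (proves-as false (core-alloc x∈X) ax))

    check-size-down : ∀ k → k ≤ s → (∀ β → β ≤ k → sizeGe? β ≡ true) ⊎ Absurd
    check-size-down k k≤s with sizeGe? k in gk
    ... | false = inj₂ (refute (proves-lower ⨾ sizeGe-mono k≤s)
                               (proves-as false (core-size (≤-trans k≤s s≤α)) gk))
    ... | true with k
    ...   | zero = inj₁ (λ { β z≤n → gk })
    ...   | suc k′ with check-size-down k′ (≤-trans (n≤1+n k′) k≤s)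
    ...     | inj₂ absurd = inj₂ absurd
    ...     | inj₁ below = inj₁ λ β β≤ → case-≤ β (m≤n⇒m<n∨m≡n β≤)
      where
      case-≤ : ∀ β → β < suc k′ ⊎ β ≡ suc k′ → sizeGe? β ≡ true
      case-≤ β (inj₁ β<) = below β (≤-pred β<)
      case-≤ β (inj₂ refl) = gk

    check-enough-size : length A ≤ s ⊎ Absurd
    check-enough-size with bounded in b
    ... | false = inj₁ (subst (length A ≤_) (sym (unbounded⇒s≡α b)) |A|≤α)
    ... | true with length A ≤? s
    ...   | yes enough = inj₁ enough
    ...   | no too-many = inj₂ (refute too-large (proves-upper b))
      where
      open CanonicalHeap X points Π Π-transfers
      φ⇒info : ∀ r → r ∈ A → ⊢ (φ ⇒ allocInfo r)
      φ⇒info r r∈A = ∧-intro (proves-as true (core-alloc (A⊆X r∈A)) (A-allocated r∈A))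
                             (⋀-intro-map _ X λ w w∈X → proves (r ↪ w) (core-↪ (A⊆X r∈A) w∈X))
      φ⇒carvable : ⊢ (φ ⇒ Π ∧' Carvable A [] true s)
      φ⇒carvable = ∧-intro φ⇒Π (∧-intro (⋀-intro-map allocInfo A φ⇒info)
                                        (∧-intro ⊤-intro (∧-intro proves-lower (proves-upper b))))
      too-large : ⊢ (φ ⇒ sizeGe (suc s))
      too-large = φ⇒carvable ⨾ carve A [] true s (distinct A⊆X A-unrelated) ⨾ canonical-size A _ true _ ⨾
                  ∧-fst ⨾ sizeGe-mono (≤-trans (≰⇒> too-many) (m≤m+n (length A) _))

  consistent? : Consistent ⊎ Absurd
  consistent? = consistent <$> all-or X check-refl
                           <*> all-or X (λ x x∈X → all-or X (check-sym x x∈X))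
                           <*> all-or X (λ x x∈X → all-or X (check-alloc x x∈X))
                           <*> all-or X (λ x x∈X → all-or X λ y y∈X → all-or X (check-points x x∈X y y∈X))
                           <*> all-or X (λ x x∈X → all-or X (check-points-alloc x x∈X))
                           <*> check-size-down s ≤-refl
                           <*> check-enough-size
    where open RawApplicative (SumRight.applicative 0ℓ Absurd)

  module Glue (c : Consistent) (pts : PVAR → PVAR → Bool)
              (pts-agrees : ∀ {r} → r ∈ A → ∀ {w} → w ∈ X → pts r w ≡ points r w)
              where

    open Consistent c
    open CanonicalHeap X pts Π Π-transfers

    junk-size : ℕ
    junk-size = s ∸ length A

    canonical : Form
    canonical = Π ∧' (Cells A ∗ Junk X bounded junk-size)

    private
      canonical-cell : ∀ {r} → r ∈ A → ⊢ (canonical ⇒ cell r ∗ ⊤')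
      canonical-cell r∈A = ∧-snd ⨾ ∗-mapˡ (cell-of A r∈A) ⨾ ∗-assoc ⨾ ∗-mapʳ ⊤-intro

      cell-points : ∀ {r w b} → w ∈ X → pts r w ≡ b → ⊢ (cell r ⇒ lit b (r ↪ w))
      cell-points {r} {w} w∈X refl = ∧-snd ⨾ ⋀-elim-map (λ w → lit (pts r w) (r ↪ w)) w∈X

      representative : ∀ {x} → x ∈ X → allocs x ≡ true →
                       ∃[ r ] (r ∈ A × E r x ≡ true × E x r ≡ true)
      representative {x} x∈X ax with Representatives.reps-cover E [] X x∈X (E-refl x x∈X)
      ... | inj₂ (r , r∈R , Erx) =
        r , ∈-filter⁺ allocated? r∈R (alloc-resp x x∈X r (R⊆X r∈R) Exr ax) , Erx , Exr
        where
        Exr : E x r ≡ true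
        Exr = E-sym r (R⊆X r∈R) x x∈X Erx

      unallocated : ∀ {x} → x ∈ X → allocs x ≡ false → ⊢ (canonical ⇒ ¬' alloc x)
      unallocated {x} x∈X ax = Cells-¬alloc x A (λ r r∈A → Π-≢ (A⊆X r∈A) x∈X (unrelated r∈A))
                                             (∧-fst ⨾ ⋀-elim-map ¬alloc x∈X)
        where
        unrelated : ∀ {r} → r ∈ A → E r x ≡ false
        unrelated {r} r∈A with E r x in Erx
        ... | false = refl
        ... | true = clash (alloc-resp r (A⊆X r∈A) x x∈X Erx (A-allocated r∈A)) ax

      glue-alloc : ∀ {x} → x ∈ X → ⊢ (canonical ⇒ lit (allocs x) (alloc x))
      glue-alloc {x} x∈X with allocs x in ax
      ... | false = unallocated x∈X ax
      ... | true with representative x∈X ax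
      ...   | r , r∈A , Erx , _ =
        ∧-intro (∧-fst ⨾ Π-≐ (A⊆X r∈A) x∈X Erx)
                (canonical-cell r∈A ⨾ Up-fromˡ (ax12 r) cell⇒alloc) ⨾
        alloc-cong r x

      -- x ↪ w holds iff the cell of x's representative r points to w
      glue-↪ : ∀ {x w} → x ∈ X → w ∈ X → ⊢ (canonical ⇒ lit (points x w) (x ↪ w))
      glue-↪ {x} {w} x∈X w∈X with points x w in pxw
      ... | true with representative x∈X (points⇒allocs x x∈X w w∈X pxw)
      ...   | r , r∈A , Erx , Exr =
        ∧-intro (∧-fst ⨾ Π-≐ (A⊆X r∈A) x∈X Erx)
                (canonical-cell r∈A ⨾ Up-fromˡ (ax14d r w) (cell-points w∈X prw)) ⨾
        ↪-cong r x w
        where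
        prw : pts r w ≡ true
        prw = trans (pts-agrees r∈A w∈X) (points-resp x x∈X r (A⊆X r∈A) w w∈X Exr pxw)
      glue-↪ {x} {w} x∈X w∈X | false with allocs x in ax
      ... | false = unallocated x∈X ax ⨾ contrapose (ax3 x w)
      ... | true with representative x∈X ax
      ...   | r , r∈A , Erx , Exr =
        ¬-intro (∧-intro (∧-fst ⨾ ∧-fst ⨾ Π-≐ x∈X (A⊆X r∈A) Exr) ∧-snd ⨾ ↪-cong x r w)
                (canonical-cell r∈A ⨾ ∗-mapˡ (∧-intro cell⇒alloc (cell-points w∈X prw)) ⨾ ax16 r w)
        where
        prw : pts r w ≡ false
        prw with points r w in prw′
        ... | false = trans (pts-agrees r∈A w∈X) prw′
        ... | true = clash (points-resp r (A⊆X r∈A) x x∈X w w∈X Erx prw′) pxw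

      canonical-size′ : ⊢ (canonical ⇒ sizeIs bounded (length A + junk-size))
      canonical-size′ = ∧-snd ⨾ canonical-size A X bounded junk-size

      canonical-bounded : bounded ≡ true → ⊢ (canonical ⇒ ¬' sizeGe (suc s))
      canonical-bounded b =
        canonical-size′ ⨾ subst (λ e → ⊢ (sizeIs e (length A + junk-size) ⇒ ¬' sizeGe (suc s))) (sym b) exactly-s
        where
        exactly-s : ⊢ (sizeEq (length A + junk-size) ⇒ ¬' sizeGe (suc s))
        exactly-s = subst (λ n → ⊢ (sizeEq n ⇒ ¬' sizeGe (suc s))) (sym (m+[n∸m]≡n enough-size)) ∧-snd

      bounded-below : ∀ {β} → β ≤ α → ¬ (β ≤ s) → bounded ≡ true
      bounded-below {β} β≤α β≰s with bounded in b
      ... | true = refl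
      ... | false = ⊥-elim (β≰s (subst (β ≤_) (sym (unbounded⇒s≡α b)) β≤α))

      glue-size : ∀ {β} → β ≤ α → ⊢ (canonical ⇒ lit (sizeGe? β) (sizeGe β))
      glue-size {β} β≤α with sizeGe? β in gβ | β ≤? s
      ... | true | yes β≤s =
        canonical-size′ ⨾ sizeIs⇒sizeGe bounded _ ⨾ sizeGe-mono (≤-trans β≤s (m≤n+m∸n s (length A)))
      ... | true | no β≰s = clash gβ (top-max sizeGe? α β β≤α (≰⇒> β≰s))
      ... | false | yes β≤s = clash (size-down β β≤s) gβ
      ... | false | no β≰s =
        canonical-bounded (bounded-below β≤α β≰s) ⨾ contrapose (sizeGe-mono (≰⇒> β≰s))

      glue-≐ : ∀ {x y} → x ∈ X → y ∈ X → ⊢ (canonical ⇒ lit (pol (x ≐ y)) (x ≐ y))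
      glue-≐ {x} {y} x∈X y∈X =
        subst (λ b → ⊢ (canonical ⇒ lit b (x ≐ y))) (sym (E-agrees x∈X y∈X)) (∧-fst ⨾ Π-lit x∈X y∈X)

    glue : ⊢ (canonical ⇒ φ)
    glue = characterised λ where
      _ (inj₁ (x , y , x∈X , y∈X , refl)) → glue-≐ x∈X y∈X
      _ (inj₂ (inj₁ (x , x∈X , refl))) → glue-alloc x∈X
      _ (inj₂ (inj₂ (inj₁ (x , w , x∈X , w∈X , refl)))) → glue-↪ x∈X w∈X
      _ (inj₂ (inj₂ (inj₂ (β , β≤α , refl)))) → glue-size β≤α

sizeLits : Bool → ℕ → List Form
sizeLits true k = sizeGe k ∷ ¬' sizeGe (suc k) ∷ []
sizeLits false k = sizeGe k ∷ []

sizeLits-intro : ∀ {G} e k → ⊢ (G ⇒ sizeIs e k) → ∀ {l} → l ∈ sizeLits e k → ⊢ (G ⇒ l)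
sizeLits-intro true k h (here refl) = h ⨾ ∧-fst
sizeLits-intro true k h (there (here refl)) = h ⨾ ∧-snd
sizeLits-intro false k h (here refl) = h

sizeLits-elim : ∀ {G} e k → (∀ {l} → l ∈ sizeLits e k → ⊢ (G ⇒ l)) → ⊢ (G ⇒ sizeIs e k)
sizeLits-elim true k h = ∧-intro (h (here refl)) (h (there (here refl)))
sizeLits-elim false k h = h (here refl)

sizeLits-literals : ∀ {X β} e k → k ≤ β → (e ≡ true → suc k ≤ β) →
                    All (IsLiteral X β) (sizeLits e k)
sizeLits-literals true k k≤β k<β =
  inj₁ (core-size k≤β) All.∷ lit-literal false (core-size (k<β refl)) All.∷ All.[]
sizeLits-literals false k k≤β _ = inj₁ (core-size k≤β) All.∷ All.[]

sizeIs-join : ∀ e₁ e₂ a b → ⊢ (sizeIs e₁ a ∗ sizeIs e₂ b ⇒ sizeIs (e₁ ∧ e₂) (a + b))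
sizeIs-join true true a b = sizeEq-+ a b
sizeIs-join true false a b = ∗-mapˡ ∧-fst ⨾ sizeGe-+ a b
sizeIs-join false e₂ a b = ∗-mapʳ (sizeIs⇒sizeGe e₂ b) ⨾ sizeGe-+ a b

-- Its literal description χ: the equalities of φ₁; x is allocated iff it
-- is in φ₁ or in φ₂; x ↪ w iff it holds in φ₁ or in φ₂; the size is at
-- least s₁ + s₂, and exactly s₁ + s₂ when both sizes are exact.

module Composition (X : List PVAR) (α : ℕ) (|X|≤α : length X ≤ α)
                   (φ₁ φ₂ : Form) (type₁ : IsCoreType X α φ₁) (type₂ : IsCoreType X α φ₂) where

  module T₁ = CoreType X α φ₁ type₁
  module T₂ = CoreType X α φ₂ type₂

  E : PVAR → PVAR → Bool
  E x y = T₁.pol (x ≐ y)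

  open EqualityPattern X E

  allocs? : PVAR → Bool
  allocs? x = T₁.pol (alloc x) ∨ T₂.pol (alloc x)

  points? : PVAR → PVAR → Bool
  points? x w = T₁.pol (x ↪ w) ∨ T₂.pol (x ↪ w)

  size : ℕ
  size = T₁.s + T₂.s

  exact : Bool
  exact = T₁.bounded ∧ T₂.bounded

  alloc-lit : PVAR → Form
  alloc-lit x = lit (allocs? x) (alloc x)

  ↪-lit : PVAR → PVAR → Form
  ↪-lit x w = lit (points? x w) (x ↪ w)

  ↪-lits : List Form
  ↪-lits = cartesianProductWith ↪-lit X X

  χ-lits : List Form
  χ-lits = ≐-lits ++ map alloc-lit X ++ ↪-lits ++ sizeLits exact size

  χ : Form
  χ = conj χ-lits

  χ-cases : ∀ {P : Form → Set} →
            (∀ x y → x ∈ X → y ∈ X → P (≐-lit x y)) → (∀ x → x ∈ X → P (alloc-lit x)) →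
            (∀ x w → x ∈ X → w ∈ X → P (↪-lit x w)) → (∀ {l} → l ∈ sizeLits exact size → P l) →
            ∀ {l} → l ∈ χ-lits → P l
  χ-cases {P} P≐ Palloc P↪ Psize l∈ with ∈-++⁻ ≐-lits l∈
  ... | inj₁ l∈≐ = pairs-all P ≐-lit X P≐ l∈≐
  ... | inj₂ l∈′ with ∈-++⁻ (map alloc-lit X) l∈′
  ...   | inj₁ l∈alloc = map-all P alloc-lit Palloc l∈alloc
  ...   | inj₂ l∈″ with ∈-++⁻ ↪-lits l∈″
  ...     | inj₁ l∈↪ = pairs-all P ↪-lit X P↪ l∈↪
  ...     | inj₂ l∈size = Psize l∈size

  χ-literals : All (IsLiteral X (2 * α)) χ-lits
  χ-literals = All.tabulate (χ-cases (λ x y x∈X y∈X → lit-literal (E x y) (core-≐ x∈X y∈X))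
                                     (λ x x∈X → lit-literal (allocs? x) (core-alloc x∈X))
                                     (λ x w x∈X w∈X → lit-literal (points? x w) (core-↪ x∈X w∈X))
                                     size-literal)
    where
    2α≡α+α : 2 * α ≡ α + α
    2α≡α+α = cong (α +_) (+-identityʳ α)
    size≤2α : size ≤ 2 * α
    size≤2α = subst (size ≤_) (sym 2α≡α+α) (+-mono-≤ T₁.s≤α T₂.s≤α)
    exact⇒size<2α : exact ≡ true → suc size ≤ 2 * α
    exact⇒size<2α e =
      subst (suc size ≤_) (sym 2α≡α+α)
            (+-mono-≤ (T₁.bounded⇒s<α (∧-conicalˡ _ _ e)) (<⇒≤ (T₂.bounded⇒s<α (∧-conicalʳ _ _ e))))
    size-literal : ∀ {l} → l ∈ sizeLits exact size → IsLiteral X (2 * α) l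
    size-literal = All.lookup (sizeLits-literals exact size size≤2α exact⇒size<2α)

  private
    alloc₁ : ∀ {x} b → x ∈ X → T₁.pol (alloc x) ≡ b → ⊢ (φ₁ ⇒ lit b (alloc x))
    alloc₁ b x∈X = T₁.proves-as b (core-alloc x∈X)

    alloc₂ : ∀ {x} b → x ∈ X → T₂.pol (alloc x) ≡ b → ⊢ (φ₂ ⇒ lit b (alloc x))
    alloc₂ b x∈X = T₂.proves-as b (core-alloc x∈X)

    ↪₁ : ∀ {x w} b → x ∈ X → w ∈ X → T₁.pol (x ↪ w) ≡ b → ⊢ (φ₁ ⇒ lit b (x ↪ w))
    ↪₁ b x∈X w∈X = T₁.proves-as b (core-↪ x∈X w∈X)

    ↪₂ : ∀ {x w} b → x ∈ X → w ∈ X → T₂.pol (x ↪ w) ≡ b → ⊢ (φ₂ ⇒ lit b (x ↪ w))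
    ↪₂ b x∈X w∈X = T₂.proves-as b (core-↪ x∈X w∈X)

  -- Every literal of χ holds of φ₁ ∗ φ₂: positive facts are upward closed
  -- and come from one side, negative ones are combined by axioms 15 and 16.
  private
    forward-alloc : ∀ x → x ∈ X → ⊢ (φ₁ ∗ φ₂ ⇒ alloc-lit x)
    forward-alloc x x∈X with T₁.pol (alloc x) in a₁ | T₂.pol (alloc x) in a₂
    ... | true | _ = Up-fromˡ (ax12 x) (alloc₁ true x∈X a₁)
    ... | false | true = Up-fromʳ (ax12 x) (alloc₂ true x∈X a₂)
    ... | false | false = ∗-map (alloc₁ false x∈X a₁) (alloc₂ false x∈X a₂) ⨾ ax15 x

    forward-↪ : ∀ x w → x ∈ X → w ∈ X → ⊢ (φ₁ ∗ φ₂ ⇒ ↪-lit x w)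
    forward-↪ x w x∈X w∈X with T₁.pol (x ↪ w) in p₁ | T₂.pol (x ↪ w) in p₂
    ... | true | _ = Up-fromˡ (ax14d x w) (↪₁ true x∈X w∈X p₁)
    ... | false | true = Up-fromʳ (ax14d x w) (↪₂ true x∈X w∈X p₂)
    ... | false | false with T₁.pol (alloc x) in a₁ | T₂.pol (alloc x) in a₂
    ...   | true | _ =
      ∗-map (∧-intro (alloc₁ true x∈X a₁) (↪₁ false x∈X w∈X p₁)) ⊤-intro ⨾ ax16 x w
    ...   | false | true =
      ∗-comm ⨾ ∗-map (∧-intro (alloc₂ true x∈X a₂) (↪₂ false x∈X w∈X p₂)) ⊤-intro ⨾ ax16 x w
    ...   | false | false =
      ∗-map (alloc₁ false x∈X a₁) (alloc₂ false x∈X a₂) ⨾ ax15 x ⨾ contrapose (ax3 x w)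

    forward-≐ : ∀ x y → x ∈ X → y ∈ X → ⊢ (φ₁ ∗ φ₂ ⇒ ≐-lit x y)
    forward-≐ x y x∈X y∈X = Up-fromˡ (Up-lit-≐ (E x y) x y) (T₁.proves (x ≐ y) (core-≐ x∈X y∈X))

    forward-size : ⊢ (φ₁ ∗ φ₂ ⇒ sizeIs exact size)
    forward-size = ∗-map T₁.proves-size T₂.proves-size ⨾ sizeIs-join T₁.bounded T₂.bounded T₁.s T₂.s

  forward : ⊢ (φ₁ ∗ φ₂ ⇒ χ)
  forward = conj-intro χ-lits (χ-cases forward-≐ forward-alloc forward-↪ (sizeLits-intro exact size forward-size))

  -- The converse holds unless φ₁ ∗ φ₂ is refutable: this is the case when
  -- the two types disagree on an equality, both allocate a variable, or
  -- one of them is itself inconsistent.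
  Absurd : Set
  Absurd = ⊢ (φ₁ ∗ φ₂ ⇒ ⊥')

  private
    check-agree : ∀ x → x ∈ X → ∀ y → y ∈ X → T₂.pol (x ≐ y) ≡ E x y ⊎ Absurd
    check-agree x x∈X y y∈X with T₂.pol (x ≐ y) in e₂ | E x y in e₁
    ... | true | true = inj₁ refl
    ... | false | false = inj₁ refl
    ... | true | false = inj₂ (refute (Up-fromʳ (ax14b x y) (T₂.proves-as true (core-≐ x∈X y∈X) e₂))
                                      (Up-fromˡ (ax14c x y) (T₁.proves-as false (core-≐ x∈X y∈X) e₁)))
    ... | false | true = inj₂ (refute (Up-fromˡ (ax14b x y) (T₁.proves-as true (core-≐ x∈X y∈X) e₁))
                                      (Up-fromʳ (ax14c x y) (T₂.proves-as false (core-≐ x∈X y∈X) e₂)))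

    check-disjoint : ∀ x → x ∈ X → (T₁.pol (alloc x) ≡ true → T₂.pol (alloc x) ≡ false) ⊎ Absurd
    check-disjoint x x∈X with T₁.pol (alloc x) in a₁ | T₂.pol (alloc x) in a₂
    ... | false | _ = inj₁ (λ ())
    ... | true | false = inj₁ (λ _ → refl)
    ... | true | true = inj₂ (∗-map (alloc₁ true x∈X a₁) (alloc₂ true x∈X a₂) ⨾ ⇔-to (ax13 x))

  module C₁ = Canonical X α |X|≤α φ₁ type₁ E (λ _ _ → refl)

  -- For consistent, compatible φ₁ and φ₂, χ describes the disjoint union
  -- of the two canonical heaps.
  module Backward (agree : ∀ {x y} → x ∈ X → y ∈ X → T₂.pol (x ≐ y) ≡ E x y)
                  (disjoint : ∀ {x} → x ∈ X →
                              T₁.pol (alloc x) ≡ true → T₂.pol (alloc x) ≡ false)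
                  where

    module C₂ = Canonical X α |X|≤α φ₂ type₂ E agree
    open CanonicalHeap X points? Π Π-transfers

    module _ (c₁ : C₁.Consistent) (c₂ : C₂.Consistent) where
      open C₁.Consistent c₁ using (E-refl; E-sym)
        renaming (alloc-resp to alloc-resp₁; points⇒allocs to points⇒allocs₁; enough-size to enough-size₁)
      open C₂.Consistent c₂ using ()
        renaming (alloc-resp to alloc-resp₂; points⇒allocs to points⇒allocs₂; enough-size to enough-size₂)

      rs : List PVAR
      rs = C₁.A ++ C₂.A

      unallocated? : ∀ x → Dec (allocs? x ≡ false)
      unallocated? x = allocs? x Bool.≟ false

      Z : List PVAR
      Z = filter unallocated? X

      private
        χ-lit : ∀ {l} → l ∈ χ-lits → ⊢ (χ ⇒ l)
        χ-lit = conj-elim χ-lits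

        χ⇒Π : ⊢ (χ ⇒ Π)
        χ⇒Π = ⋀-intro ≐-lits (λ l∈ → χ-lit (∈-++⁺ˡ l∈))

        χ⇒alloc-lit : ∀ {x} → x ∈ X → ⊢ (χ ⇒ alloc-lit x)
        χ⇒alloc-lit x∈X = χ-lit (∈-++⁺ʳ ≐-lits (∈-++⁺ˡ (∈-map⁺ alloc-lit x∈X)))

        χ⇒↪-lit : ∀ {x w} → x ∈ X → w ∈ X → ⊢ (χ ⇒ ↪-lit x w)
        χ⇒↪-lit x∈X w∈X =
          χ-lit (∈-++⁺ʳ ≐-lits (∈-++⁺ʳ (map alloc-lit X)
                                      (∈-++⁺ˡ (∈-cartesianProductWith⁺ ↪-lit x∈X w∈X))))

        χ⇒size : ⊢ (χ ⇒ sizeIs exact size)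
        χ⇒size = sizeLits-elim exact size λ l∈ →
                   χ-lit (∈-++⁺ʳ ≐-lits (∈-++⁺ʳ (map alloc-lit X) (∈-++⁺ʳ ↪-lits l∈)))

        rs-⊆X : ∀ {r} → r ∈ rs → r ∈ X
        rs-⊆X r∈rs with ∈-++⁻ C₁.A r∈rs
        ... | inj₁ r∈A₁ = C₁.A⊆X r∈A₁
        ... | inj₂ r∈A₂ = C₂.A⊆X r∈A₂

        rs-allocated : ∀ {r} → r ∈ rs → allocs? r ≡ true
        rs-allocated {r} r∈rs with ∈-++⁻ C₁.A r∈rs
        ... | inj₁ r∈A₁ rewrite C₁.A-allocated r∈A₁ = refl
        ... | inj₂ r∈A₂ rewrite C₂.A-allocated r∈A₂ = ∨-zeroʳ (T₁.pol (alloc r))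

        χ⇒carvable : ⊢ (χ ⇒ Π ∧' Carvable rs Z exact size)
        χ⇒carvable = ∧-intro χ⇒Π (∧-intro (⋀-intro-map allocInfo rs info) (∧-intro unallocated χ⇒size))
          where
          info : ∀ r → r ∈ rs → ⊢ (χ ⇒ allocInfo r)
          info r r∈rs =
            ∧-intro (subst (λ b → ⊢ (χ ⇒ lit b (alloc r))) (rs-allocated r∈rs) (χ⇒alloc-lit (rs-⊆X r∈rs)))
                    (⋀-intro-map _ X λ w w∈X → χ⇒↪-lit (rs-⊆X r∈rs) w∈X)
          unallocated : ⊢ (χ ⇒ unalloc Z)
          unallocated = ⋀-intro-map ¬alloc Z λ z z∈Z →
            let (z∈X , az) = ∈-filter⁻ unallocated? {xs = X} z∈Z in
            subst (λ b → ⊢ (χ ⇒ lit b (alloc z))) az (χ⇒alloc-lit z∈X)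

        across : ∀ {r r′} → r ∈ C₁.A → r′ ∈ C₂.A → E r r′ ≡ false
        across {r} {r′} r∈A₁ r′∈A₂ with r ℕ.≟ r′
        ... | yes refl = clash (C₂.A-allocated r′∈A₂) (disjoint (C₁.A⊆X r∈A₁) (C₁.A-allocated r∈A₁))
        ... | no r≢r′
          with AllPairs-lookup (Representatives.reps-unrelated E [] X) (C₁.A⊆R r∈A₁) (C₂.A⊆R r′∈A₂) r≢r′
        ...   | inj₁ Err′ = Err′
        ...   | inj₂ Er′r with E r r′ in Err′
        ...     | false = refl
        ...     | true = clash (E-sym r (C₁.A⊆X r∈A₁) r′ (C₂.A⊆X r′∈A₂) Err′) Er′r

        rs-distinct : Distinct rs
        rs-distinct = distinct rs-⊆X (AllPairs.++⁺ C₁.A-unrelated C₂.A-unrelated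
                                        (All.tabulate λ r∈A₁ → All.tabulate (across r∈A₁)))

        -- junk allocating none of Z and rs allocates no variable of X:
        -- every allocated variable is Π-equal to its representative in rs
        junk-covers : ∀ k → ⊢ (Junk (Z ++ rs) exact k ∧' Π ⇒ Junk X exact k)
        junk-covers k = ∧-intro (⋀-intro-map ¬alloc X unallocated) (∧-fst ⨾ ∧-snd)
          where
          J : Form
          J = Junk (Z ++ rs) exact k ∧' Π
          representative : ∀ {x} → x ∈ X → ∃[ r ] (r ∈ C₁.R × E x r ≡ true)
          representative {x} x∈X with Representatives.reps-cover E [] X x∈X (E-refl x x∈X)
          ... | inj₂ (r , r∈R , Erx) = r , r∈R , E-sym r (C₁.R⊆X r∈R) x x∈X Erx
          via-rep : ∀ {x r} → x ∈ X → r ∈ C₁.R → E x r ≡ true → r ∈ rs → ⊢ (J ⇒ ¬alloc x)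
          via-rep {x} {r} x∈X r∈R Exr r∈rs =
            ¬-intro (∧-intro (∧-fst ⨾ ∧-snd ⨾ Π-≐ x∈X (C₁.R⊆X r∈R) Exr) ∧-snd ⨾ alloc-cong x r)
                    (∧-fst ⨾ ∧-fst ⨾ ⋀-elim-map ¬alloc (∈-++⁺ʳ Z r∈rs))
          unallocated : ∀ x → x ∈ X → ⊢ (J ⇒ ¬alloc x)
          unallocated x x∈X with T₁.pol (alloc x) in a₁ | T₂.pol (alloc x) in a₂ | representative x∈X
          ... | false | false | _ =
            ∧-fst ⨾ ∧-fst ⨾ ⋀-elim-map ¬alloc (∈-++⁺ˡ (∈-filter⁺ unallocated? x∈X ax))
            where
            ax : allocs? x ≡ false
            ax = subst₂ (λ a b → a ∨ b ≡ false) (sym a₁) (sym a₂) refl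
          ... | true | _ | r , r∈R , Exr =
            via-rep x∈X r∈R Exr
                    (∈-++⁺ˡ (∈-filter⁺ C₁.allocated? r∈R (alloc-resp₁ x x∈X r (C₁.R⊆X r∈R) Exr a₁)))
          ... | false | true | r , r∈R , Exr =
            via-rep x∈X r∈R Exr
                    (∈-++⁺ʳ C₁.A (∈-filter⁺ C₂.allocated? r∈R
                                             (alloc-resp₂ x x∈X r (C₁.R⊆X r∈R) Exr a₂)))

        points?-agrees₁ : ∀ {r} → r ∈ C₁.A → ∀ {w} → w ∈ X → points? r w ≡ T₁.pol (r ↪ w)
        points?-agrees₁ {r} r∈A₁ {w} w∈X with T₂.pol (r ↪ w) in p₂
        ... | false = ∨-identityʳ (T₁.pol (r ↪ w))
        ... | true = clash (points⇒allocs₂ r (C₁.A⊆X r∈A₁) w w∈X p₂)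
                           (disjoint (C₁.A⊆X r∈A₁) (C₁.A-allocated r∈A₁))

        points?-agrees₂ : ∀ {r} → r ∈ C₂.A → ∀ {w} → w ∈ X → points? r w ≡ T₂.pol (r ↪ w)
        points?-agrees₂ {r} r∈A₂ {w} w∈X with T₁.pol (r ↪ w) in p₁
        ... | false = refl
        ... | true = clash (C₂.A-allocated r∈A₂)
                           (disjoint (C₂.A⊆X r∈A₂) (points⇒allocs₁ r (C₂.A⊆X r∈A₂) w w∈X p₁))

      module G₁ = C₁.Glue c₁ points? points?-agrees₁
      module G₂ = C₂.Glue c₂ points? points?-agrees₂

      Side₁ Side₂ : Form
      Side₁ = Cells C₁.A ∗ Junk X T₁.bounded G₁.junk-size
      Side₂ = Cells C₂.A ∗ Junk X T₂.bounded G₂.junk-size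

      -- carve the cells of both sides and the junk out of χ, split the
      -- junk between the sides and glue each side to its type
      backward : ⊢ (χ ⇒ φ₁ ∗ φ₂)
      backward = split-Π ⨾ ∗-map (∧-swap ⨾ G₁.glue) (∧-swap ⨾ G₂.glue)
        where
        junk-sizes : size ∸ length rs ≡ G₁.junk-size + G₂.junk-size
        junk-sizes = trans (cong (size ∸_) (length-++ C₁.A))
                           ([a+b]∸[c+d]≡[a∸c]+[b∸d] T₁.s T₂.s enough-size₁ enough-size₂)
        carved : ⊢ (χ ⇒ Cells rs ∗ Junk X exact (G₁.junk-size + G₂.junk-size))
        carved = subst (λ k → ⊢ (χ ⇒ Cells rs ∗ Junk X exact k)) junk-sizes
                   (transferʳ (χ⇒carvable ⨾ carve rs Z exact size rs-distinct) Π-transfers χ⇒Π ⨾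
                    ∗-mapʳ (junk-covers _))
        split : ⊢ (χ ⇒ Side₁ ∗ Side₂)
        split = carved ⨾ ∗-map (Cells-++ C₁.A C₂.A) (Junk-split X T₁.bounded T₂.bounded _ _) ⨾ ∗-interchange
        split-Π : ⊢ (χ ⇒ (Side₁ ∧' Π) ∗ (Side₂ ∧' Π))
        split-Π = transferʳ (transferˡ split Π-transfers χ⇒Π) Π-transfers χ⇒Π

  private
    from-compatible : (∀ {x y} → x ∈ X → y ∈ X → T₂.pol (x ≐ y) ≡ E x y) →
                      (∀ {x} → x ∈ X → T₁.pol (alloc x) ≡ true → T₂.pol (alloc x) ≡ false) →
                      Absurd ⊎ ⊢ (χ ⇒ φ₁ ∗ φ₂)
    from-compatible agree disjoint with C₁.consistent? | Backward.C₂.consistent? agree disjoint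
    ... | inj₂ absurd₁ | _ = inj₁ (∗-⊥ˡ absurd₁)
    ... | inj₁ _ | inj₂ absurd₂ = inj₁ (∗-⊥ʳ absurd₂)
    ... | inj₁ c₁ | inj₁ c₂ = inj₂ (Backward.backward agree disjoint c₁ c₂)

  backward? : Absurd ⊎ ⊢ (χ ⇒ φ₁ ∗ φ₂)
  backward? with all-or X (λ x x∈X → all-or X (check-agree x x∈X)) | all-or X check-disjoint
  ... | inj₂ absurd | _ = inj₁ absurd
  ... | inj₁ _ | inj₂ absurd = inj₁ absurd
  ... | inj₁ agree | inj₁ disjoint =
    from-compatible (λ x∈X y∈X → agree _ x∈X _ y∈X) (λ x∈X → disjoint _ x∈X)

-- Corollary 5.5: φ ∗ ψ is equivalent to a conjunction of literals over
-- Core(X, 2α) — to χ if φ ∗ ψ is consistent, and to ⊥ otherwise.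

-- ⊥ is the one-literal conjunction ¬(size ≥ 0)
⊥-as-literal : ∀ {X β} → IsLitConj X β (¬' sizeGe 0)
⊥-as-literal = (¬' sizeGe 0 ∷ []) , (lit-literal false (core-size z≤n) All.∷ All.[]) , refl

corollary5p5 : (X : List PVAR) → Unique X → (α : ℕ) → length X ≤ α →
    (φ ψ : Form) → IsCoreType X α φ → IsCoreType X α ψ →
    ∃[ χ ] (IsLitConj X (2 * α) χ × (⊢ ((φ ∗ ψ) ⇔ χ)))
corollary5p5 X _ α |X|≤α φ ψ type-φ type-ψ
  with Composition.backward? X α |X|≤α φ ψ type-φ type-ψ
... | inj₁ absurd = ¬' sizeGe 0 , ⊥-as-literal , ⇔-intro (ex-falso absurd) (ex-falso ¬¬-elim)
... | inj₂ backward = χ , (χ-lits , χ-literals , refl) , ⇔-intro forward backward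
  where open Composition X α |X|≤α φ ψ type-φ type-ψ
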